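{- Let $p$ be a prime and $x\in\mathbb{Z}_p$. For every integer $m\ge0$, \[ B_m(1-x)=(-1)^m\int_{\mathbb{Z}_p}(x+y)^m\,d\mu_0(y)=\sum_{n=0}^{m}\widehat{D}_n(x)\,S_2(m,n). \] In particular, \[ B_m(1-x)=(-1)^mB_m(x)=\sum_{n=0}^{m}\widehat{D}_n(x)\,S_2(m,n). \]
   Context: The Bernoulli polynomials are defined by $\frac{t}{e^t-1}e^{xt}=\sum_{n\ge0}B_n(x)\frac{t^n}{n!}$. The Daehee polynomials of the second kind $\widehat{D}_n(x)$ are defined by $\frac{(1+t)\log(1+t)}{t}\cdot\frac{1}{(1+t)^x}=\sum_{n\ge0}\widehat{D}_n(x)\frac{t^n}{n!}$. The Stirling numbers of the second kind are defined by $(e^t-1)^m=m!\sum_{l\ge m}S_2(l,m)\frac{t^l}{l!}$. For a uniformly differentiable function $f:\mathbb{Z}_p\to\mathbb{C}_p$, the $p$-adic invariant (Volkenborn) integral is $\int_{\mathbb{Z}_p}f(y)\,d\mu_0(y)=\lim_{N\to\infty}\frac{1}{p^N}\sum_{y=0}^{p^N-1}f(y)$. -}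

module Defs where

open import Data.Nat as ℕ using (ℕ; zero; suc; _∸_; _≤_; NonZero; nonTrivial⇒nonZero)
open import Data.Nat.Divisibility using (_∣_)
open import Data.Nat.Primality using (Prime; prime)
open import Data.Integer as ℤ using (ℤ; +_; ∣_∣)
open import Data.Rational using (ℚ; _+_; _*_; _-_; -_; _/_; 0ℚ; 1ℚ; ↥_)
open import Data.List using (List; []; _∷_)
open import Data.Product using (∃)

ℤ→ℚ : ℤ → ℚ
ℤ→ℚ z = z / 1

ℕ→ℚ : ℕ → ℚ
ℕ→ℚ n = + n / 1

infixr 8 _^ℚ_
_^ℚ_ : ℚ → ℕ → ℚ
q ^ℚ zero  = 1ℚ
q ^ℚ suc n = q * (q ^ℚ n)

sumTo : ℕ → (ℕ → ℚ) → ℚ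
sumTo zero    f = f 0
sumTo (suc n) f = sumTo n f + f (suc n)

sumBelow : ℕ → (ℕ → ℚ) → ℚ
sumBelow zero    f = 0ℚ
sumBelow (suc n) f = sumBelow n f + f n

factℚ : ℕ → ℚ
factℚ zero    = 1ℚ
factℚ (suc n) = ℕ→ℚ (suc n) * factℚ n

invFact : ℕ → ℚ
invFact zero    = 1ℚ
invFact (suc n) = invFact n * (+ 1 / suc n)

Series : Set
Series = ℕ → ℚ

oneS : Series
oneS zero    = 1ℚ
oneS (suc _) = 0ℚ

_⊛_ : Series → Series → Series
(a ⊛ b) n = sumTo n (λ i → a i * b (n ∸ i))

powS : Series → ℕ → Series
powS s zero    = oneS
powS s (suc m) = s ⊛ powS s m

nth : List ℚ → ℕ → ℚ
nth []       _       = 0ℚ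
nth (c ∷ _)  zero    = c
nth (_ ∷ cs) (suc i) = nth cs i

-- For a series a with constant term 1, the list [c n, c (n-1), …, c 0]
-- of coefficients of its multiplicative inverse 1/a, determined by
-- c 0 = 1 and c n = - Σ_{i=1}^{n} a i * c (n - i).
invUpTo : Series → ℕ → List ℚ
invUpTo a zero    = 1ℚ ∷ []
invUpTo a (suc n) =
  (- sumTo n (λ j → a (suc j) * nth (invUpTo a n) j)) ∷ invUpTo a n

invS : Series → Series
invS a n = nth (invUpTo a n) 0

expS : Series
expS n = invFact n

expXS : ℚ → Series
expXS x n = (x ^ℚ n) * invFact n

expM1 : Series
expM1 zero    = 0ℚ
expM1 (suc n) = invFact (suc n)

expM1OverT : Series
expM1OverT n = invFact (suc n)

logOverT : Series
logOverT n = ((- 1ℚ) ^ℚ n) * (+ 1 / suc n)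

onePlusT : Series
onePlusT zero          = 1ℚ
onePlusT (suc zero)    = 1ℚ
onePlusT (suc (suc _)) = 0ℚ

-- (1+t)^a = Σ binom(a,n) t^n, binom(a,n) = a(a-1)…(a-n+1)/n!
falling : ℚ → ℕ → ℚ
falling a zero    = 1ℚ
falling a (suc n) = falling a n * (a - ℕ→ℚ n)

binomS : ℚ → Series
binomS a n = falling a n * invFact n

-- Bernoulli polynomials:  t/(e^t-1) e^{xt} = Σ B_n(x) t^n/n!

bernoulli : ℕ → ℚ → ℚ
bernoulli n x = factℚ n * ((invS expM1OverT ⊛ expXS x) n)

-- Daehee polynomials of the second kind:
--   (1+t) log(1+t)/t · (1+t)^{-x} = Σ D̂_n(x) t^n/n!

daehee2 : ℕ → ℚ → ℚ
daehee2 n x = factℚ n * (((onePlusT ⊛ logOverT) ⊛ binomS (- x)) n)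

-- Stirling numbers of the second kind:
--   (e^t - 1)^m = m! Σ_{l} S₂(l,m) t^l/l!

stirling2 : ℕ → ℕ → ℚ
stirling2 l m = factℚ l * invFact m * powS expM1 m l

-- v_p(q) ≥ k  (for q in lowest terms: p^k divides the numerator)
ValGe : ℕ → ℕ → ℚ → Set
ValGe p k q = (p ℕ.^ k) ∣ ∣ ↥ q ∣

-- An element of ℤ_p, represented by a p-adically Cauchy sequence of
-- integers: p^k ∣ x (k+1) - x k.
IsZp : ℕ → (ℕ → ℤ) → Set
IsZp p x = ∀ k → (p ℕ.^ k) ∣ ∣ x (suc k) ℤ.- x k ∣

-- Elements of ℚ_p, represented by p-adically Cauchy sequences of
-- rationals; equality of ℚ_p is p-adic equivalence of sequences.
Qp : Set
Qp = ℕ → ℚ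

_≈[_]_ : Qp → ℕ → Qp → Set
a ≈[ p ] b = ∀ k → ∃ λ J → ∀ j → J ≤ j → ValGe p k (a j - b j)

ConvergesTo : ℕ → (ℕ → Qp) → Qp → Set
ConvergesTo p A L =
  ∀ k → ∃ λ N₀ → ∀ N → N₀ ≤ N → ∃ λ J → ∀ j → J ≤ j → ValGe p k (A N j - L j)

invPow : ∀ {p} → Prime p → ℕ → ℚ
invPow {p} (prime _) N = ((+ 1 / p) {{nonTrivial⇒nonZero p}}) ^ℚ N

volkenbornSum : ∀ {p} → Prime p → (ℕ → Qp) → ℕ → Qp
volkenbornSum {p} pr f N j = invPow pr N * sumBelow (p ℕ.^ N) (λ y → f y j)

VolkenbornIntegral : ∀ {p} → Prime p → (ℕ → Qp) → Qp → Set
VolkenbornIntegral {p} pr f L = ConvergesTo p (volkenbornSum pr f) L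

{-# OPTIONS --safe #-}
-- Everything is read off formal power series over ℚ. Substituting t ↦ e^t - 1 turns (1+t)^a
-- into e^{at} and log(1+t) into t (by uniqueness for first-order differential equations), so
-- it sends the Daehee generating function at x to t e^{(1-x)t}/(e^t - 1), the Bernoulli
-- generating function at 1 - x; on coefficients this substitution is the Stirling transform,
-- which gives the Daehee–Stirling expansion. The reflection t ↦ -t gives
-- B_m(1-x) = (-1)^m B_m(x). For the integral, Faulhaber's formula writes p^{-N} Σ_{y<p^N} (x+y)^m
-- as B_m(x) plus p^N times a rational whose denominator is bounded independently of N and x,
-- so the Riemann sums converge p-adically to B_m(x) = (-1)^m B_m(1-x).
module Submission where

open import Defs
open import Data.Nat as ℕ using (ℕ; zero; suc; _≤_; _<_; z≤n; s≤s; _∸_)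
import Data.Nat.Properties as ℕP
open import Data.Nat.Divisibility
  using (_∣_; divides; ∣-trans; *-cancelˡ-∣; *-monoʳ-∣; m∣m*n; 1∣_; _∣?_; ∣⇒≤; _∣0)
open import Data.Nat.Primality using (Prime; prime; euclidsLemma; prime⇒nonZero; prime⇒nonTrivial)
open import Data.Integer as ℤ using (ℤ; +_)
import Data.Integer.Properties as ℤP
open import Data.Rational using (ℚ; mkℚ; _+_; _*_; _-_; -_; 1ℚ; 0ℚ; _/_; toℚᵘ; fromℚᵘ)
import Data.Rational.Properties as ℚP
import Data.Rational.Unnormalised as U
import Data.Rational.Unnormalised.Properties as UP
open import Data.Rational.Solver using (module +-*-Solver)
open +-*-Solver using (solve; _:+_; _:*_; _:-_; :-_; _:=_; con)
open import Data.Product using (Σ; _,_; proj₁; proj₂; _×_)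
open import Data.Sum using (inj₁; inj₂)
open import Data.Empty using (⊥-elim)
open import Relation.Nullary using (yes; no; ¬_)
open import Relation.Binary.PropositionalEquality

fromℚᵘ-homo-+ : ∀ u v → fromℚᵘ (u U.+ v) ≡ fromℚᵘ u + fromℚᵘ v
fromℚᵘ-homo-+ u v = ℚP.toℚᵘ-injective (UP.≃-trans (ℚP.toℚᵘ-fromℚᵘ (u U.+ v))
  (UP.≃-trans (UP.+-cong (UP.≃-sym (ℚP.toℚᵘ-fromℚᵘ u)) (UP.≃-sym (ℚP.toℚᵘ-fromℚᵘ v)))
    (UP.≃-sym (ℚP.toℚᵘ-homo-+ (fromℚᵘ u) (fromℚᵘ v)))))

fromℚᵘ-homo-* : ∀ u v → fromℚᵘ (u U.* v) ≡ fromℚᵘ u * fromℚᵘ v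
fromℚᵘ-homo-* u v = ℚP.toℚᵘ-injective (UP.≃-trans (ℚP.toℚᵘ-fromℚᵘ (u U.* v))
  (UP.≃-trans (UP.*-cong (UP.≃-sym (ℚP.toℚᵘ-fromℚᵘ u)) (UP.≃-sym (ℚP.toℚᵘ-fromℚᵘ v)))
    (UP.≃-sym (ℚP.toℚᵘ-homo-* (fromℚᵘ u) (fromℚᵘ v)))))

ℤ→ℚ-homo-+ : ∀ a b → ℤ→ℚ (a ℤ.+ b) ≡ ℤ→ℚ a + ℤ→ℚ b
ℤ→ℚ-homo-+ a b = trans (ℚP.fromℚᵘ-cong {U.mkℚᵘ (a ℤ.+ b) 0} {U.mkℚᵘ a 0 U.+ U.mkℚᵘ b 0} (U.*≡* eq)) (fromℚᵘ-homo-+ (U.mkℚᵘ a 0) (U.mkℚᵘ b 0))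
  where
  eq : (a ℤ.+ b) ℤ.* + 1 ≡ (a ℤ.* + 1 ℤ.+ b ℤ.* + 1) ℤ.* + 1
  eq = cong (ℤ._* + 1) (sym (cong₂ ℤ._+_ (ℤP.*-identityʳ a) (ℤP.*-identityʳ b)))

ℤ→ℚ-homo-* : ∀ a b → ℤ→ℚ (a ℤ.* b) ≡ ℤ→ℚ a * ℤ→ℚ b
ℤ→ℚ-homo-* a b = trans (ℚP.fromℚᵘ-cong {U.mkℚᵘ (a ℤ.* b) 0} {U.mkℚᵘ a 0 U.* U.mkℚᵘ b 0} (U.*≡* refl))
  (fromℚᵘ-homo-* (U.mkℚᵘ a 0) (U.mkℚᵘ b 0))

ℕ→ℚ-homo-+ : ∀ m n → ℕ→ℚ (m ℕ.+ n) ≡ ℕ→ℚ m + ℕ→ℚ n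
ℕ→ℚ-homo-+ m n = ℤ→ℚ-homo-+ (+ m) (+ n)

ℕ→ℚ-homo-* : ∀ m n → ℕ→ℚ (m ℕ.* n) ≡ ℕ→ℚ m * ℕ→ℚ n
ℕ→ℚ-homo-* m n = trans (cong ℤ→ℚ (ℤP.pos-* m n)) (ℤ→ℚ-homo-* (+ m) (+ n))

ℕ→ℚ-homo-^ : ∀ a n → ℕ→ℚ (a ℕ.^ n) ≡ ℕ→ℚ a ^ℚ n
ℕ→ℚ-homo-^ a zero    = refl
ℕ→ℚ-homo-^ a (suc n) = trans (ℕ→ℚ-homo-* a (a ℕ.^ n)) (cong (ℕ→ℚ a *_) (ℕ→ℚ-homo-^ a n))

ℕ→ℚ*1/≡1 : ∀ n .{{_ : ℕ.NonZero n}} → ℕ→ℚ n * (+ 1 / n) ≡ 1ℚ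
ℕ→ℚ*1/≡1 (suc n) = trans (sym (fromℚᵘ-homo-* (U.mkℚᵘ (+ suc n) 0) (U.mkℚᵘ (+ 1) n)))
  (ℚP.fromℚᵘ-cong {U.mkℚᵘ (+ suc n) 0 U.* U.mkℚᵘ (+ 1) n} {U.mkℚᵘ (+ 1) 0} (U.*≡* (trans (ℤP.*-identityʳ _) (trans (ℤP.*-identityʳ _)
    (trans (cong +_ (sym (ℕP.*-identityˡ (suc n)))) (sym (ℤP.*-identityˡ _)))))))

ℕ→ℚ-suc-*-cancelˡ : ∀ n {u v} → ℕ→ℚ (suc n) * u ≡ ℕ→ℚ (suc n) * v → u ≡ v
ℕ→ℚ-suc-*-cancelˡ n {u} {v} eq = begin
  u              ≡⟨ solve 3 (λ N r u → u := r :* (N :* u) :+ (con 1ℚ :- N :* r) :* u) refl N r u ⟩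
  r * (N * u) + (1ℚ - N * r) * u ≡⟨ cong₂ (λ a b → r * a + (1ℚ - b) * u) eq (ℕ→ℚ*1/≡1 (suc n)) ⟩
  r * (N * v) + (1ℚ - 1ℚ) * u    ≡⟨ solve 4 (λ N r u v → r :* (N :* v) :+ (con 1ℚ :- con 1ℚ) :* u := (N :* r) :* v) refl N r u v ⟩
  (N * r) * v    ≡⟨ cong (_* v) (ℕ→ℚ*1/≡1 (suc n)) ⟩
  1ℚ * v         ≡⟨ ℚP.*-identityˡ v ⟩
  v              ∎
  where
  open ≡-Reasoning
  N = ℕ→ℚ (suc n)
  r = + 1 / suc n

1^ℚn≡1 : ∀ n → 1ℚ ^ℚ n ≡ 1ℚ
1^ℚn≡1 zero    = refl
1^ℚn≡1 (suc n) = cong (1ℚ *_) (1^ℚn≡1 n)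

^ℚ-distribˡ-+-* : ∀ q i j → q ^ℚ (i ℕ.+ j) ≡ q ^ℚ i * q ^ℚ j
^ℚ-distribˡ-+-* q zero    j = sym (ℚP.*-identityˡ _)
^ℚ-distribˡ-+-* q (suc i) j =
  trans (cong (q *_) (^ℚ-distribˡ-+-* q i j)) (sym (ℚP.*-assoc q (q ^ℚ i) (q ^ℚ j)))

^ℚ-distribʳ-* : ∀ p q n → (p * q) ^ℚ n ≡ p ^ℚ n * q ^ℚ n
^ℚ-distribʳ-* p q zero    = refl
^ℚ-distribʳ-* p q (suc n) = trans (cong ((p * q) *_) (^ℚ-distribʳ-* p q n))
  (solve 4 (λ p q x y → (p :* q) :* (x :* y) := (p :* x) :* (q :* y)) refl p q (p ^ℚ n) (q ^ℚ n))

[-1]^n*[-1]^n≡1 : ∀ n → (- 1ℚ) ^ℚ n * (- 1ℚ) ^ℚ n ≡ 1ℚ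
[-1]^n*[-1]^n≡1 n = trans (sym (^ℚ-distribʳ-* (- 1ℚ) (- 1ℚ) n)) (1^ℚn≡1 n)

ℕ→ℚ-suc*invFact-suc : ∀ n → ℕ→ℚ (suc n) * invFact (suc n) ≡ invFact n
ℕ→ℚ-suc*invFact-suc n = begin
  N * (invFact n * r)  ≡⟨ solve 3 (λ N f r → N :* (f :* r) := (N :* r) :* f) refl N (invFact n) r ⟩
  (N * r) * invFact n  ≡⟨ cong (_* invFact n) (ℕ→ℚ*1/≡1 (suc n)) ⟩
  1ℚ * invFact n       ≡⟨ ℚP.*-identityˡ (invFact n) ⟩
  invFact n            ∎
  where
  open ≡-Reasoning
  N = ℕ→ℚ (suc n)
  r = + 1 / suc n

factℚ*invFact≡1 : ∀ n → factℚ n * invFact n ≡ 1ℚ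
factℚ*invFact≡1 zero    = refl
factℚ*invFact≡1 (suc n) = begin
  (N * factℚ n) * (invFact n * r)  ≡⟨ solve 4 (λ N F f r → (N :* F) :* (f :* r) := (N :* r) :* (F :* f)) refl
                                        N (factℚ n) (invFact n) r ⟩
  (N * r) * (factℚ n * invFact n)  ≡⟨ cong₂ _*_ (ℕ→ℚ*1/≡1 (suc n)) (factℚ*invFact≡1 n) ⟩
  1ℚ                               ∎
  where
  open ≡-Reasoning
  N = ℕ→ℚ (suc n)
  r = + 1 / suc n

sumTo-cong≤ : ∀ n {f g : ℕ → ℚ} → (∀ i → i ≤ n → f i ≡ g i) → sumTo n f ≡ sumTo n g
sumTo-cong≤ zero    eq = eq 0 z≤n
sumTo-cong≤ (suc n) eq =
  cong₂ _+_ (sumTo-cong≤ n (λ i i≤n → eq i (ℕP.m≤n⇒m≤1+n i≤n))) (eq (suc n) ℕP.≤-refl)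

sumTo-cong : ∀ n {f g : ℕ → ℚ} → (∀ i → f i ≡ g i) → sumTo n f ≡ sumTo n g
sumTo-cong n eq = sumTo-cong≤ n (λ i _ → eq i)

sumTo-zero : ∀ n {f : ℕ → ℚ} → (∀ i → i ≤ n → f i ≡ 0ℚ) → sumTo n f ≡ 0ℚ
sumTo-zero n eq = trans (sumTo-cong≤ n eq) (sumTo-0 n)
  where
  sumTo-0 : ∀ n → sumTo n (λ _ → 0ℚ) ≡ 0ℚ
  sumTo-0 zero    = refl
  sumTo-0 (suc n) = trans (cong (_+ 0ℚ) (sumTo-0 n)) (ℚP.+-identityʳ 0ℚ)

sumTo-single : ∀ n j {f : ℕ → ℚ} → j ≤ n → (∀ i → i ≤ n → i ≢ j → f i ≡ 0ℚ) → sumTo n f ≡ f j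
sumTo-single zero    .zero z≤n _ = refl
sumTo-single (suc n) j {f} j≤1+n off with ℕP.m≤n⇒m<n∨m≡n j≤1+n
... | inj₁ (s≤s j≤n) =
  trans (cong (λ w → sumTo n f + w) (off (suc n) ℕP.≤-refl (λ e → ℕP.<-irrefl (sym e) (s≤s j≤n))))
    (trans (ℚP.+-identityʳ (sumTo n f)) (sumTo-single n j j≤n (λ i i≤n → off i (ℕP.m≤n⇒m≤1+n i≤n))))
... | inj₂ refl =
  trans (cong (_+ f (suc n)) (sumTo-zero n (λ i i≤n → off i (ℕP.m≤n⇒m≤1+n i≤n) (λ e → ℕP.<-irrefl e (s≤s i≤n)))))
    (ℚP.+-identityˡ (f (suc n)))

sumTo-+ : ∀ n (f g : ℕ → ℚ) → sumTo n (λ i → f i + g i) ≡ sumTo n f + sumTo n g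
sumTo-+ zero    f g = refl
sumTo-+ (suc n) f g = trans (cong (_+ (f (suc n) + g (suc n))) (sumTo-+ n f g))
  (solve 4 (λ a b c d → (a :+ b) :+ (c :+ d) := (a :+ c) :+ (b :+ d)) refl
    (sumTo n f) (sumTo n g) (f (suc n)) (g (suc n)))

sumTo-*ˡ : ∀ n c (f : ℕ → ℚ) → c * sumTo n f ≡ sumTo n (λ i → c * f i)
sumTo-*ˡ zero    c f = refl
sumTo-*ˡ (suc n) c f =
  trans (ℚP.*-distribˡ-+ c (sumTo n f) (f (suc n))) (cong (_+ c * f (suc n)) (sumTo-*ˡ n c f))

sumTo-*ʳ : ∀ n c (f : ℕ → ℚ) → sumTo n f * c ≡ sumTo n (λ i → f i * c)
sumTo-*ʳ zero    c f = refl
sumTo-*ʳ (suc n) c f =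
  trans (ℚP.*-distribʳ-+ c (sumTo n f) (f (suc n))) (cong (_+ f (suc n) * c) (sumTo-*ʳ n c f))

sumTo-shift : ∀ n (f : ℕ → ℚ) → sumTo (suc n) f ≡ f 0 + sumTo n (λ i → f (suc i))
sumTo-shift zero    f = refl
sumTo-shift (suc n) f = trans (cong (_+ f (suc (suc n))) (sumTo-shift n f))
  (ℚP.+-assoc (f 0) (sumTo n (λ i → f (suc i))) (f (suc (suc n))))

sumTo-reverse : ∀ n (f : ℕ → ℚ) → sumTo n f ≡ sumTo n (λ i → f (n ∸ i))
sumTo-reverse zero    f = refl
sumTo-reverse (suc n) f = trans (cong (_+ f (suc n)) (sumTo-reverse n f))
  (trans (ℚP.+-comm (sumTo n (λ i → f (n ∸ i))) (f (suc n))) (sym (sumTo-shift n (λ i → f (suc n ∸ i)))))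

sumTo-comm : ∀ n m (g : ℕ → ℕ → ℚ) →
  sumTo n (λ i → sumTo m (λ j → g i j)) ≡ sumTo m (λ j → sumTo n (λ i → g i j))
sumTo-comm zero    m g = refl
sumTo-comm (suc n) m g = trans (cong (_+ sumTo m (g (suc n))) (sumTo-comm n m g))
  (sym (sumTo-+ m (λ j → sumTo n (λ i → g i j)) (g (suc n))))

sumTo-extend : ∀ n M {f : ℕ → ℚ} → n ≤ M → (∀ i → n < i → i ≤ M → f i ≡ 0ℚ) → sumTo n f ≡ sumTo M f
sumTo-extend n M {f} n≤M vanish =
  trans (extend (M ∸ n) (λ i n<i i≤ → vanish i n<i (subst (i ≤_) n+[M∸n]≡M i≤)))
    (cong (λ k → sumTo k f) n+[M∸n]≡M)
  where
  n+[M∸n]≡M = ℕP.m+[n∸m]≡n n≤M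
  extend : ∀ k → (∀ i → n < i → i ≤ n ℕ.+ k → f i ≡ 0ℚ) → sumTo n f ≡ sumTo (n ℕ.+ k) f
  extend zero    _      rewrite ℕP.+-identityʳ n = refl
  extend (suc k) vanish rewrite ℕP.+-suc n k =
    trans (extend k (λ i n<i i≤ → vanish i n<i (ℕP.m≤n⇒m≤1+n i≤)))
      (sym (trans (cong (λ w → sumTo (n ℕ.+ k) f + w) (vanish (suc (n ℕ.+ k)) (s≤s (ℕP.m≤m+n n k)) ℕP.≤-refl))
        (ℚP.+-identityʳ _)))

sumTo-triangle : ∀ m (h : ℕ → ℕ → ℚ) →
  sumTo m (λ s → sumTo s (λ n → h n s)) ≡ sumTo m (λ n → sumTo (m ∸ n) (λ k → h n (n ℕ.+ k)))
sumTo-triangle zero    h = refl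
sumTo-triangle (suc m) h = sym (begin
    sumTo m (λ n → sumTo (suc m ∸ n) (λ k → h n (n ℕ.+ k))) + sumTo (m ∸ m) (λ k → h (suc m) (suc m ℕ.+ k))
  ≡⟨ cong₂ _+_ (sumTo-cong≤ m column)
       (trans (cong (λ k → sumTo k (λ k → h (suc m) (suc m ℕ.+ k))) (ℕP.n∸n≡0 m))
         (cong (h (suc m)) (ℕP.+-identityʳ (suc m)))) ⟩
    sumTo m (λ n → sumTo (m ∸ n) (λ k → h n (n ℕ.+ k)) + h n (suc m)) + h (suc m) (suc m)
  ≡⟨ cong (_+ h (suc m) (suc m)) (sumTo-+ m _ _) ⟩
    (sumTo m (λ n → sumTo (m ∸ n) (λ k → h n (n ℕ.+ k))) + sumTo m (λ n → h n (suc m))) + h (suc m) (suc m)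
  ≡⟨ ℚP.+-assoc (sumTo m (λ n → sumTo (m ∸ n) (λ k → h n (n ℕ.+ k)))) _ _ ⟩
    sumTo m (λ n → sumTo (m ∸ n) (λ k → h n (n ℕ.+ k))) + sumTo (suc m) (λ n → h n (suc m))
  ≡⟨ cong (_+ sumTo (suc m) (λ n → h n (suc m))) (sym (sumTo-triangle m h)) ⟩
    sumTo m (λ s → sumTo s (λ n → h n s)) + sumTo (suc m) (λ n → h n (suc m))
  ∎)
  where
  open ≡-Reasoning
  column : ∀ n → n ≤ m →
    sumTo (suc m ∸ n) (λ k → h n (n ℕ.+ k)) ≡ sumTo (m ∸ n) (λ k → h n (n ℕ.+ k)) + h n (suc m)
  column n n≤m = trans (cong (λ k → sumTo k (λ k → h n (n ℕ.+ k))) (ℕP.+-∸-assoc 1 n≤m))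
    (cong (λ k → sumTo (m ∸ n) (λ k → h n (n ℕ.+ k)) + h n k)
      (trans (ℕP.+-suc n (m ∸ n)) (cong suc (ℕP.m+[n∸m]≡n n≤m))))

sumBelow-cong : ∀ H {g g' : ℕ → ℚ} → (∀ y → g y ≡ g' y) → sumBelow H g ≡ sumBelow H g'
sumBelow-cong zero    eq = refl
sumBelow-cong (suc H) eq = cong₂ _+_ (sumBelow-cong H eq) (eq H)

sumBelow-*ˡ : ∀ H c (g : ℕ → ℚ) → c * sumBelow H g ≡ sumBelow H (λ y → c * g y)
sumBelow-*ˡ zero    c g = ℚP.*-zeroʳ c
sumBelow-*ˡ (suc H) c g =
  trans (ℚP.*-distribˡ-+ c (sumBelow H g) (g H)) (cong (_+ c * g H) (sumBelow-*ˡ H c g))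

infix 4 _≐_
_≐_ : Series → Series → Set
a ≐ b = ∀ n → a n ≡ b n

≐-refl : ∀ {a} → a ≐ a
≐-refl n = refl

≐-sym : ∀ {a b} → a ≐ b → b ≐ a
≐-sym eq n = sym (eq n)

≐-trans : ∀ {a b c} → a ≐ b → b ≐ c → a ≐ c
≐-trans eq eq′ n = trans (eq n) (eq′ n)

infixl 6 _⊕_
_⊕_ : Series → Series → Series
(a ⊕ b) n = a n + b n

infixr 7 _⊙_
_⊙_ : ℚ → Series → Series
(c ⊙ a) n = c * a n

⊛-cong : ∀ {a a′ b b′} → a ≐ a′ → b ≐ b′ → (a ⊛ b) ≐ (a′ ⊛ b′)
⊛-cong eqa eqb n = sumTo-cong n (λ i → cong₂ _*_ (eqa i) (eqb (n ∸ i)))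

⊛-congˡ : ∀ {a a′} b → a ≐ a′ → (a ⊛ b) ≐ (a′ ⊛ b)
⊛-congˡ b eq = ⊛-cong eq (≐-refl {b})

⊛-congʳ : ∀ a {b b′} → b ≐ b′ → (a ⊛ b) ≐ (a ⊛ b′)
⊛-congʳ a eq = ⊛-cong (≐-refl {a}) eq

⊛-comm : ∀ a b → (a ⊛ b) ≐ (b ⊛ a)
⊛-comm a b n = trans (sumTo-reverse n (λ i → a i * b (n ∸ i)))
  (sumTo-cong≤ n (λ i i≤n → trans (ℚP.*-comm (a (n ∸ i)) (b (n ∸ (n ∸ i))))
    (cong (λ k → b k * a (n ∸ i)) (ℕP.m∸[m∸n]≡n i≤n))))

⊛-assoc : ∀ a b c → ((a ⊛ b) ⊛ c) ≐ (a ⊛ (b ⊛ c))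
⊛-assoc a b c m = begin
    sumTo m (λ s → sumTo s (λ n → a n * b (s ∸ n)) * c (m ∸ s))
  ≡⟨ sumTo-cong m (λ s → sumTo-*ʳ s (c (m ∸ s)) (λ n → a n * b (s ∸ n))) ⟩
    sumTo m (λ s → sumTo s (λ n → a n * b (s ∸ n) * c (m ∸ s)))
  ≡⟨ sumTo-triangle m (λ n s → a n * b (s ∸ n) * c (m ∸ s)) ⟩
    sumTo m (λ n → sumTo (m ∸ n) (λ k → a n * b ((n ℕ.+ k) ∸ n) * c (m ∸ (n ℕ.+ k))))
  ≡⟨ sumTo-cong m (λ n → trans (sumTo-cong (m ∸ n) (λ k →
        trans (cong₂ (λ u v → a n * b u * c v) (ℕP.m+n∸m≡n n k) (sym (ℕP.∸-+-assoc m n k)))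
              (ℚP.*-assoc (a n) (b k) (c (m ∸ n ∸ k)))))
        (sym (sumTo-*ˡ (m ∸ n) (a n) (λ k → b k * c (m ∸ n ∸ k))))) ⟩
    sumTo m (λ n → a n * sumTo (m ∸ n) (λ k → b k * c (m ∸ n ∸ k)))
  ∎
  where open ≡-Reasoning

⊛-distribʳ-⊕ : ∀ a b c → ((b ⊕ c) ⊛ a) ≐ ((b ⊛ a) ⊕ (c ⊛ a))
⊛-distribʳ-⊕ a b c n = trans (sumTo-cong n (λ i → ℚP.*-distribʳ-+ (a (n ∸ i)) (b i) (c i)))
  (sumTo-+ n (λ i → b i * a (n ∸ i)) (λ i → c i * a (n ∸ i)))

⊛-distribˡ-⊕ : ∀ a b c → (a ⊛ (b ⊕ c)) ≐ ((a ⊛ b) ⊕ (a ⊛ c))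
⊛-distribˡ-⊕ a b c n = trans (sumTo-cong n (λ i → ℚP.*-distribˡ-+ (a i) (b (n ∸ i)) (c (n ∸ i))))
  (sumTo-+ n (λ i → a i * b (n ∸ i)) (λ i → a i * c (n ∸ i)))

⊙-⊛-assoc : ∀ c a b → ((c ⊙ a) ⊛ b) ≐ (c ⊙ (a ⊛ b))
⊙-⊛-assoc c a b n = trans (sumTo-cong n (λ i → ℚP.*-assoc c (a i) (b (n ∸ i))))
  (sym (sumTo-*ˡ n c (λ i → a i * b (n ∸ i))))

⊛-⊙-comm : ∀ c a b → (a ⊛ (c ⊙ b)) ≐ (c ⊙ (a ⊛ b))
⊛-⊙-comm c a b n =
  trans (sumTo-cong n (λ i → solve 3 (λ x y z → x :* (y :* z) := y :* (x :* z)) refl (a i) c (b (n ∸ i))))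
    (sym (sumTo-*ˡ n c (λ i → a i * b (n ∸ i))))

⊛-identityˡ : ∀ a → (oneS ⊛ a) ≐ a
⊛-identityˡ a zero    = ℚP.*-identityˡ (a 0)
⊛-identityˡ a (suc n) = trans (sumTo-shift n (λ i → oneS i * a (suc n ∸ i)))
  (trans (cong₂ _+_ (ℚP.*-identityˡ (a (suc n))) (sumTo-zero n (λ i _ → ℚP.*-zeroˡ (a (n ∸ i)))))
    (ℚP.+-identityʳ (a (suc n))))

⊛-identityʳ : ∀ a → (a ⊛ oneS) ≐ a
⊛-identityʳ a = ≐-trans (⊛-comm a oneS) (⊛-identityˡ a)

⊛-zeroʳ : ∀ a n → (a ⊛ (λ _ → 0ℚ)) n ≡ 0ℚ
⊛-zeroʳ a n = sumTo-zero n (λ i _ → ℚP.*-zeroʳ (a i))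

⊛-interchange : ∀ a b c d → ((a ⊛ b) ⊛ (c ⊛ d)) ≐ ((a ⊛ c) ⊛ (b ⊛ d))
⊛-interchange a b c d =
  ≐-trans (⊛-assoc a b (c ⊛ d))
    (≐-trans (⊛-congʳ a (≐-trans (≐-sym (⊛-assoc b c d))
                          (≐-trans (⊛-congˡ d (⊛-comm b c)) (⊛-assoc c b d))))
      (≐-sym (⊛-assoc a c (b ⊛ d))))

nth-invUpTo : ∀ a n j → j ≤ n → nth (invUpTo a n) j ≡ invS a (n ∸ j)
nth-invUpTo a zero    zero    z≤n       = refl
nth-invUpTo a (suc n) zero    z≤n       = refl
nth-invUpTo a (suc n) (suc j) (s≤s j≤n) = nth-invUpTo a n j j≤n

⊛-inverseʳ : ∀ a → a 0 ≡ 1ℚ → (a ⊛ invS a) ≐ oneS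
⊛-inverseʳ a a0≡1 zero    = cong (_* 1ℚ) a0≡1
⊛-inverseʳ a a0≡1 (suc n) = trans (sumTo-shift n (λ i → a i * invS a (suc n ∸ i)))
  (trans (cong (_+ S) (trans (cong₂ _*_ a0≡1 invS-suc) (ℚP.*-identityˡ (- S)))) (ℚP.+-inverseˡ S))
  where
  S = sumTo n (λ j → a (suc j) * invS a (n ∸ j))
  invS-suc : invS a (suc n) ≡ - S
  invS-suc = cong -_ (sumTo-cong≤ n (λ j j≤n → cong (a (suc j) *_) (nth-invUpTo a n j j≤n)))

⊛-inverseˡ : ∀ a → a 0 ≡ 1ℚ → (invS a ⊛ a) ≐ oneS
⊛-inverseˡ a a0≡1 = ≐-trans (⊛-comm (invS a) a) (⊛-inverseʳ a a0≡1)

invS-unique : ∀ a b → a 0 ≡ 1ℚ → (a ⊛ b) ≐ oneS → b ≐ invS a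
invS-unique a b a0≡1 ab≐1 =
  ≐-trans (≐-sym (⊛-identityˡ b))
    (≐-trans (⊛-congˡ b (≐-sym (⊛-inverseˡ a a0≡1)))
      (≐-trans (⊛-assoc (invS a) a b)
        (≐-trans (⊛-congʳ (invS a) ab≐1) (⊛-identityʳ (invS a)))))

shiftS : Series → Series
shiftS a zero    = 0ℚ
shiftS a (suc n) = a n

shiftS-injective : ∀ {a b} → shiftS a ≐ shiftS b → a ≐ b
shiftS-injective eq n = eq (suc n)

tS : Series
tS = shiftS oneS

tS-⊛ : ∀ a → (tS ⊛ a) ≐ shiftS a
tS-⊛ a zero    = ℚP.*-zeroˡ (a 0)
tS-⊛ a (suc n) = trans (sumTo-shift n (λ i → tS i * a (suc n ∸ i)))
  (trans (cong (_+ sumTo n (λ i → oneS i * a (n ∸ i))) (ℚP.*-zeroˡ (a (suc n))))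
    (trans (ℚP.+-identityˡ (sumTo n (λ i → oneS i * a (n ∸ i)))) (⊛-identityˡ a n)))

shiftS-⊛ : ∀ a b → (shiftS a ⊛ b) ≐ shiftS (a ⊛ b)
shiftS-⊛ a b = ≐-trans (⊛-congˡ b (≐-sym (tS-⊛ a))) (≐-trans (⊛-assoc tS a b) (tS-⊛ (a ⊛ b)))

∂ : Series → Series
∂ a n = ℕ→ℚ (suc n) * a (suc n)

∂-cong : ∀ {a b} → a ≐ b → ∂ a ≐ ∂ b
∂-cong eq n = cong (ℕ→ℚ (suc n) *_) (eq (suc n))

∂-⊛ : ∀ a b → ∂ (a ⊛ b) ≐ ((∂ a ⊛ b) ⊕ (a ⊛ ∂ b))
∂-⊛ a b n = sym (begin
    sumTo n (λ i → (ℕ→ℚ (suc i) * a (suc i)) * b (n ∸ i))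
      + sumTo n (λ i → a i * (ℕ→ℚ (suc (n ∸ i)) * b (suc (n ∸ i))))
  ≡⟨ cong₂ _+_ left right ⟩
    sumTo (suc n) (λ i → ℕ→ℚ i * X i) + sumTo (suc n) (λ i → ℕ→ℚ (suc n ∸ i) * X i)
  ≡⟨ sym (sumTo-+ (suc n) (λ i → ℕ→ℚ i * X i) (λ i → ℕ→ℚ (suc n ∸ i) * X i)) ⟩
    sumTo (suc n) (λ i → ℕ→ℚ i * X i + ℕ→ℚ (suc n ∸ i) * X i)
  ≡⟨ sumTo-cong≤ (suc n) (λ i i≤ → trans (sym (ℚP.*-distribʳ-+ (X i) (ℕ→ℚ i) (ℕ→ℚ (suc n ∸ i))))
        (cong (_* X i) (trans (sym (ℕ→ℚ-homo-+ i (suc n ∸ i))) (cong ℕ→ℚ (ℕP.m+[n∸m]≡n i≤))))) ⟩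
    sumTo (suc n) (λ i → ℕ→ℚ (suc n) * X i)
  ≡⟨ sym (sumTo-*ˡ (suc n) (ℕ→ℚ (suc n)) X) ⟩
    ℕ→ℚ (suc n) * sumTo (suc n) X
  ∎)
  where
  open ≡-Reasoning
  X : ℕ → ℚ
  X i = a i * b (suc n ∸ i)
  left : sumTo n (λ i → (ℕ→ℚ (suc i) * a (suc i)) * b (n ∸ i)) ≡ sumTo (suc n) (λ i → ℕ→ℚ i * X i)
  left = sym (trans (sumTo-shift n (λ i → ℕ→ℚ i * X i))
    (trans (cong (_+ sumTo n (λ i → ℕ→ℚ (suc i) * X (suc i))) (ℚP.*-zeroˡ (X 0)))
      (trans (ℚP.+-identityˡ _)
        (sumTo-cong n (λ i → sym (ℚP.*-assoc (ℕ→ℚ (suc i)) (a (suc i)) (b (n ∸ i))))))))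
  right : sumTo n (λ i → a i * (ℕ→ℚ (suc (n ∸ i)) * b (suc (n ∸ i))))
        ≡ sumTo (suc n) (λ i → ℕ→ℚ (suc n ∸ i) * X i)
  right = sym (trans (cong (λ w → sumTo n (λ i → ℕ→ℚ (suc n ∸ i) * X i) + w)
      (trans (cong (λ k → ℕ→ℚ k * X (suc n)) (ℕP.n∸n≡0 n)) (ℚP.*-zeroˡ (X (suc n)))))
    (trans (ℚP.+-identityʳ _)
      (sumTo-cong≤ n (λ i i≤n → trans (cong (λ k → ℕ→ℚ k * (a i * b k)) (ℕP.+-∸-assoc 1 i≤n))
        (solve 3 (λ x y z → x :* (y :* z) := y :* (x :* z)) refl
          (ℕ→ℚ (suc (n ∸ i))) (a i) (b (suc (n ∸ i))))))))

∂-injective : ∀ y z → ∂ y ≐ ∂ z → y 0 ≡ z 0 → y ≐ z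
∂-injective y z eq eq₀ zero    = eq₀
∂-injective y z eq eq₀ (suc n) = ℕ→ℚ-suc-*-cancelˡ n (eq n)

∂≐⊙-unique : ∀ c y z → ∂ y ≐ (c ⊙ y) → ∂ z ≐ (c ⊙ z) → y 0 ≡ z 0 → y ≐ z
∂≐⊙-unique c y z ∂y ∂z eq₀ zero    = eq₀
∂≐⊙-unique c y z ∂y ∂z eq₀ (suc n) =
  ℕ→ℚ-suc-*-cancelˡ n (trans (∂y n) (trans (cong (c *_) (∂≐⊙-unique c y z ∂y ∂z eq₀ n)) (sym (∂z n))))

∂-expXS : ∀ c → ∂ (expXS c) ≐ (c ⊙ expXS c)
∂-expXS c n = trans (solve 3 (λ N f y → N :* (y :* f) := y :* (N :* f)) refl
    (ℕ→ℚ (suc n)) (invFact (suc n)) (c * c ^ℚ n))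
  (trans (cong ((c * c ^ℚ n) *_) (ℕ→ℚ-suc*invFact-suc n)) (ℚP.*-assoc c (c ^ℚ n) (invFact n)))

expXS-+ : ∀ a b → (expXS a ⊛ expXS b) ≐ expXS (a + b)
expXS-+ a b = ∂≐⊙-unique (a + b) (expXS a ⊛ expXS b) (expXS (a + b)) ∂-product (∂-expXS (a + b)) refl
  where
  ∂-product : ∂ (expXS a ⊛ expXS b) ≐ ((a + b) ⊙ (expXS a ⊛ expXS b))
  ∂-product n = trans (∂-⊛ (expXS a) (expXS b) n)
    (trans (cong₂ _+_ (trans (⊛-congˡ (expXS b) (∂-expXS a) n) (⊙-⊛-assoc a (expXS a) (expXS b) n))
                      (trans (⊛-congʳ (expXS a) (∂-expXS b) n) (⊛-⊙-comm b (expXS a) (expXS b) n)))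
      (sym (ℚP.*-distribʳ-+ ((expXS a ⊛ expXS b) n) a b)))

expXS-0 : expXS 0ℚ ≐ oneS
expXS-0 zero    = refl
expXS-0 (suc n) = trans (cong (_* invFact (suc n)) (ℚP.*-zeroˡ (0ℚ ^ℚ n))) (ℚP.*-zeroˡ (invFact (suc n)))

expS≐expXS1 : expS ≐ expXS 1ℚ
expS≐expXS1 n = sym (trans (cong (_* invFact n) (1^ℚn≡1 n)) (ℚP.*-identityˡ (invFact n)))

-- The substitution a(g(t)); truncating the sum at n ≤ m is exact only when g 0 ≡ 0ℚ.
compS : Series → Series → Series
compS a g m = sumTo m (λ n → a n * powS g n m)

compS-cong : ∀ {a b} g → a ≐ b → compS a g ≐ compS b g
compS-cong g eq m = sumTo-cong m (λ n → cong (_* powS g n m) (eq n))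

compS-⊕ : ∀ a b g → compS (a ⊕ b) g ≐ (compS a g ⊕ compS b g)
compS-⊕ a b g m = trans (sumTo-cong m (λ n → ℚP.*-distribʳ-+ (powS g n m) (a n) (b n))) (sumTo-+ m _ _)

compS-⊙ : ∀ c a g → compS (c ⊙ a) g ≐ (c ⊙ compS a g)
compS-⊙ c a g m = trans (sumTo-cong m (λ n → ℚP.*-assoc c (a n) (powS g n m))) (sym (sumTo-*ˡ m c _))

compS-oneS : ∀ g → compS oneS g ≐ oneS
compS-oneS g m = trans (sumTo-single m 0 z≤n λ where
    zero    _ 0≢0 → ⊥-elim (0≢0 refl)
    (suc i) _ _   → ℚP.*-zeroˡ (powS g (suc i) m))
  (ℚP.*-identityˡ (oneS m))

compS-tS : ∀ g → g 0 ≡ 0ℚ → compS tS g ≐ g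
compS-tS g g0≡0 zero    = trans (ℚP.*-zeroˡ (oneS 0)) (sym g0≡0)
compS-tS g g0≡0 (suc m) = trans (sumTo-single (suc m) 1 (s≤s z≤n) λ where
    zero          _ _   → ℚP.*-zeroˡ (oneS (suc m))
    (suc zero)    _ 1≢1 → ⊥-elim (1≢1 refl)
    (suc (suc i)) _ _   → ℚP.*-zeroˡ (powS g (suc (suc i)) (suc m)))
  (trans (ℚP.*-identityˡ _) (⊛-identityʳ g (suc m)))

powS-+ : ∀ g n k → (powS g n ⊛ powS g k) ≐ powS g (n ℕ.+ k)
powS-+ g zero    k = ⊛-identityˡ (powS g k)
powS-+ g (suc n) k = ≐-trans (⊛-assoc g (powS g n) (powS g k)) (⊛-congʳ g (powS-+ g n k))

module _ (g : Series) (g0≡0 : g 0 ≡ 0ℚ) where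

  powS-vanish : ∀ n m → m < n → powS g n m ≡ 0ℚ
  powS-vanish (suc n) m (s≤s m≤n) = sumTo-zero m λ where
      zero    _    → trans (cong (_* powS g n m) g0≡0) (ℚP.*-zeroˡ (powS g n m))
      (suc i) i<m → trans (cong (g (suc i) *_) (powS-vanish n (m ∸ suc i) (lt i m i<m m≤n)))
                          (ℚP.*-zeroʳ (g (suc i)))
    where
    lt : ∀ i m → suc i ≤ m → m ≤ n → m ∸ suc i < n
    lt i (suc m) (s≤s i≤m) m≤n = ℕP.<-≤-trans (s≤s (ℕP.m∸n≤m m i)) m≤n

  compS-extend : ∀ a m M → m ≤ M → compS a g m ≡ sumTo M (λ n → a n * powS g n m)
  compS-extend a m M m≤M = sumTo-extend m M m≤M
    (λ i m<i _ → trans (cong (a i *_) (powS-vanish i m m<i)) (ℚP.*-zeroʳ (a i)))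

  private
    P : ℕ → ℕ → ℚ
    P n m = powS g n m

  compS-⊛ : ∀ a b → compS (a ⊛ b) g ≐ (compS a g ⊛ compS b g)
  compS-⊛ a b m = begin
      sumTo m (λ s → sumTo s (λ n → a n * b (s ∸ n)) * P s m)
    ≡⟨ sumTo-cong m (λ s → sumTo-*ʳ s (P s m) (λ n → a n * b (s ∸ n))) ⟩
      sumTo m (λ s → sumTo s (λ n → a n * b (s ∸ n) * P s m))
    ≡⟨ sumTo-triangle m (λ n s → a n * b (s ∸ n) * P s m) ⟩
      sumTo m (λ n → sumTo (m ∸ n) (λ k → a n * b ((n ℕ.+ k) ∸ n) * P (n ℕ.+ k) m))
    ≡⟨ sumTo-cong m (λ n → trans (sumTo-cong (m ∸ n) (λ k → cong (λ u → a n * b u * P (n ℕ.+ k) m) (ℕP.m+n∸m≡n n k)))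
          (sumTo-extend (m ∸ n) m (ℕP.m∸n≤m m n) (λ k m∸n<k _ →
             trans (cong (a n * b k *_) (powS-vanish (n ℕ.+ k) m
                     (ℕP.≤-<-trans (ℕP.m≤n+m∸n m n) (ℕP.+-monoʳ-< n m∸n<k))))
                   (ℚP.*-zeroʳ (a n * b k))))) ⟩
      sumTo m (λ n → sumTo m (λ k → a n * b k * P (n ℕ.+ k) m))
    ≡⟨ sumTo-cong m (λ n → sumTo-cong m (λ k → trans (cong (a n * b k *_) (sym (powS-+ g n k m)))
          (sumTo-*ˡ m (a n * b k) (λ i → P n i * P k (m ∸ i))))) ⟩
      sumTo m (λ n → sumTo m (λ k → sumTo m (λ i → (a n * b k) * (P n i * P k (m ∸ i)))))
    ≡⟨ trans (sumTo-cong m (λ n → sumTo-comm m m (λ k i → (a n * b k) * (P n i * P k (m ∸ i)))))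
             (sumTo-comm m m (λ n i → sumTo m (λ k → (a n * b k) * (P n i * P k (m ∸ i))))) ⟩
      sumTo m (λ i → sumTo m (λ n → sumTo m (λ k → (a n * b k) * (P n i * P k (m ∸ i)))))
    ≡⟨ sumTo-cong≤ m (λ i i≤m → trans (sumTo-cong m (λ n →
          trans (sumTo-cong m (λ k → solve 4 (λ x y z w → (x :* y) :* (z :* w) := (x :* z) :* (y :* w)) refl
                                        (a n) (b k) (P n i) (P k (m ∸ i))))
                (sym (sumTo-*ˡ m (a n * P n i) (λ k → b k * P k (m ∸ i))))))
         (trans (sym (sumTo-*ʳ m (sumTo m (λ k → b k * P k (m ∸ i))) (λ n → a n * P n i)))
           (sym (cong₂ _*_ (compS-extend a i m i≤m) (compS-extend b (m ∸ i) m (ℕP.m∸n≤m m i)))))) ⟩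
      sumTo m (λ i → compS a g i * compS b g (m ∸ i))
    ∎
    where open ≡-Reasoning

  ∂-powS : ∀ n → ∂ (powS g (suc n)) ≐ (ℕ→ℚ (suc n) ⊙ (powS g n ⊛ ∂ g))
  ∂-powS zero    m = trans (∂-cong (⊛-identityʳ g) m) (sym (trans (ℚP.*-identityˡ _) (⊛-identityˡ (∂ g) m)))
  ∂-powS (suc n) m = begin
      ∂ (g ⊛ G₁) m
    ≡⟨ ∂-⊛ g G₁ m ⟩
      (∂ g ⊛ G₁) m + (g ⊛ ∂ G₁) m
    ≡⟨ cong₂ _+_ (⊛-comm (∂ g) G₁ m)
         (trans (⊛-congʳ g (∂-powS n) m)
           (trans (⊛-⊙-comm N g (powS g n ⊛ ∂ g) m) (cong (N *_) (sym (⊛-assoc g (powS g n) (∂ g) m))))) ⟩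
      X + N * X
    ≡⟨ solve 2 (λ X N → X :+ N :* X := (con 1ℚ :+ N) :* X) refl X N ⟩
      (1ℚ + N) * X
    ≡⟨ cong (_* X) (sym (ℕ→ℚ-homo-+ 1 (suc n))) ⟩
      ℕ→ℚ (suc (suc n)) * X
    ∎
    where
    open ≡-Reasoning
    G₁ = powS g (suc n)
    N = ℕ→ℚ (suc n)
    X = (G₁ ⊛ ∂ g) m

  ∂-compS : ∀ a → ∂ (compS a g) ≐ (compS (∂ a) g ⊛ ∂ g)
  ∂-compS a m = begin
      N * sumTo (suc m) (λ n → a n * P n (suc m))
    ≡⟨ trans (sumTo-*ˡ (suc m) N (λ n → a n * P n (suc m)))
         (sumTo-cong (suc m) (λ n → solve 3 (λ x y z → x :* (y :* z) := y :* (x :* z)) refl N (a n) (P n (suc m)))) ⟩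
      sumTo (suc m) (λ n → a n * ∂ (powS g n) m)
    ≡⟨ sumTo-shift m (λ n → a n * ∂ (powS g n) m) ⟩
      a 0 * (N * 0ℚ) + sumTo m (λ n → a (suc n) * ∂ (powS g (suc n)) m)
    ≡⟨ cong₂ _+_ (trans (cong (a 0 *_) (ℚP.*-zeroʳ N)) (ℚP.*-zeroʳ (a 0)))
         (sumTo-cong m (λ n → trans (cong (a (suc n) *_) (∂-powS n m))
             (solve 3 (λ x y z → x :* (y :* z) := (y :* x) :* z) refl (a (suc n)) (ℕ→ℚ (suc n)) ((powS g n ⊛ ∂ g) m)))) ⟩
      0ℚ + sumTo m (λ n → ∂ a n * (powS g n ⊛ ∂ g) m)
    ≡⟨ ℚP.+-identityˡ _ ⟩
      sumTo m (λ n → ∂ a n * sumTo m (λ i → P n i * ∂ g (m ∸ i)))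
    ≡⟨ sumTo-cong m (λ n → trans (sumTo-*ˡ m (∂ a n) (λ i → P n i * ∂ g (m ∸ i)))
          (sumTo-cong m (λ i → sym (ℚP.*-assoc (∂ a n) (P n i) (∂ g (m ∸ i)))))) ⟩
      sumTo m (λ n → sumTo m (λ i → ∂ a n * P n i * ∂ g (m ∸ i)))
    ≡⟨ sumTo-comm m m (λ n i → ∂ a n * P n i * ∂ g (m ∸ i)) ⟩
      sumTo m (λ i → sumTo m (λ n → ∂ a n * P n i * ∂ g (m ∸ i)))
    ≡⟨ sumTo-cong≤ m (λ i i≤m → trans (sym (sumTo-*ʳ m (∂ g (m ∸ i)) (λ n → ∂ a n * P n i)))
          (cong (_* ∂ g (m ∸ i)) (sym (compS-extend (∂ a) i m i≤m)))) ⟩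
      sumTo m (λ i → compS (∂ a) g i * ∂ g (m ∸ i))
    ∎
    where
    open ≡-Reasoning
    N = ℕ→ℚ (suc m)

-- Substitution of e^t - 1

onePlusT≐oneS⊕tS : onePlusT ≐ (oneS ⊕ tS)
onePlusT≐oneS⊕tS zero          = refl
onePlusT≐oneS⊕tS (suc zero)    = refl
onePlusT≐oneS⊕tS (suc (suc n)) = refl

onePlusT-⊛ : ∀ a → (onePlusT ⊛ a) ≐ (a ⊕ shiftS a)
onePlusT-⊛ a n = trans (⊛-congˡ a onePlusT≐oneS⊕tS n)
  (trans (⊛-distribʳ-⊕ a oneS tS n) (cong₂ _+_ (⊛-identityˡ a n) (tS-⊛ a n)))

expM1≐expS⊕-1 : expM1 ≐ (expS ⊕ (- 1ℚ) ⊙ oneS)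
expM1≐expS⊕-1 zero    = refl
expM1≐expS⊕-1 (suc n) =
  sym (trans (cong (λ w → invFact (suc n) + w) (ℚP.*-zeroʳ (- 1ℚ))) (ℚP.+-identityʳ _))

tS⊛expM1OverT : (tS ⊛ expM1OverT) ≐ expM1
tS⊛expM1OverT n = trans (tS-⊛ expM1OverT n) (shift-expM1OverT n)
  where
  shift-expM1OverT : shiftS expM1OverT ≐ expM1
  shift-expM1OverT zero    = refl
  shift-expM1OverT (suc n) = refl

compS-onePlusT-expM1 : compS onePlusT expM1 ≐ expS
compS-onePlusT-expM1 n = trans (compS-cong expM1 onePlusT≐oneS⊕tS n)
  (trans (compS-⊕ oneS tS expM1 n)
    (trans (cong₂ _+_ (compS-oneS expM1 n) (compS-tS expM1 refl n)) (oneS⊕expM1 n)))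
  where
  oneS⊕expM1 : ∀ n → oneS n + expM1 n ≡ expS n
  oneS⊕expM1 zero    = refl
  oneS⊕expM1 (suc n) = ℚP.+-identityˡ (invFact (suc n))

-- Since (e^t - 1)' = e^t = (1 + t) ∘ (e^t - 1), the chain rule at e^t - 1 absorbs the inner derivative.
∂-compS-expM1 : ∀ a → ∂ (compS a expM1) ≐ compS (onePlusT ⊛ ∂ a) expM1
∂-compS-expM1 a =
  ≐-trans (∂-compS expM1 refl a)
    (≐-trans (⊛-congʳ (compS (∂ a) expM1) (≐-trans ℕ→ℚ-suc*invFact-suc (≐-sym compS-onePlusT-expM1)))
      (≐-trans (≐-sym (compS-⊛ expM1 refl (∂ a) onePlusT))
        (compS-cong expM1 (⊛-comm (∂ a) onePlusT))))

∂-binomS : ∀ c n → ∂ (binomS c) n ≡ falling c n * (c - ℕ→ℚ n) * invFact n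
∂-binomS c n = trans (solve 3 (λ N F I → N :* (F :* I) := F :* (N :* I)) refl
    (ℕ→ℚ (suc n)) (falling c (suc n)) (invFact (suc n)))
  (cong (falling c (suc n) *_) (ℕ→ℚ-suc*invFact-suc n))

onePlusT⊛∂binomS : ∀ c → (onePlusT ⊛ ∂ (binomS c)) ≐ (c ⊙ binomS c)
onePlusT⊛∂binomS c n = trans (onePlusT-⊛ (∂ (binomS c)) n) (coefficient n)
  where
  coefficient : ∀ n → ∂ (binomS c) n + shiftS (∂ (binomS c)) n ≡ c * binomS c n
  coefficient zero = trans (ℚP.+-identityʳ _) (trans (∂-binomS c 0)
    (solve 1 (λ c → (con 1ℚ :* (c :- con 0ℚ)) :* con 1ℚ := c :* (con 1ℚ :* con 1ℚ)) refl c))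
  coefficient (suc k) = begin
      ∂ (binomS c) (suc k) + ∂ (binomS c) k
    ≡⟨ cong₂ _+_ (∂-binomS c (suc k))
         (trans (∂-binomS c k) (cong (falling c (suc k) *_) (sym (ℕ→ℚ-suc*invFact-suc k)))) ⟩
      F * (c - M) * I + F * (M * I)
    ≡⟨ solve 4 (λ F c M I → F :* (c :- M) :* I :+ F :* (M :* I) := c :* (F :* I)) refl F c M I ⟩
      c * (F * I)
    ∎
    where
    open ≡-Reasoning
    F = falling c (suc k)
    M = ℕ→ℚ (suc k)
    I = invFact (suc k)

compS-binomS-expM1 : ∀ c → compS (binomS c) expM1 ≐ expXS c
compS-binomS-expM1 c = ∂≐⊙-unique c (compS (binomS c) expM1) (expXS c)
  (≐-trans (∂-compS-expM1 (binomS c))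
    (≐-trans (compS-cong expM1 (onePlusT⊛∂binomS c)) (compS-⊙ c (binomS c) expM1)))
  (∂-expXS c) refl

logS : Series
logS = shiftS logOverT

onePlusT⊛∂logS : (onePlusT ⊛ ∂ logS) ≐ oneS
onePlusT⊛∂logS n = trans (onePlusT-⊛ (∂ logS) n) (coefficient n)
  where
  ∂logS : ∀ n → ∂ logS n ≡ (- 1ℚ) ^ℚ n
  ∂logS n = trans (solve 3 (λ N s r → N :* (s :* r) := (N :* r) :* s) refl
      (ℕ→ℚ (suc n)) ((- 1ℚ) ^ℚ n) (+ 1 / suc n))
    (trans (cong (_* ((- 1ℚ) ^ℚ n)) (ℕ→ℚ*1/≡1 (suc n))) (ℚP.*-identityˡ _))
  coefficient : ∀ n → ∂ logS n + shiftS (∂ logS) n ≡ oneS n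
  coefficient zero    = refl
  coefficient (suc k) = trans (cong₂ _+_ (∂logS (suc k)) (∂logS k))
    (solve 1 (λ s → (:- con 1ℚ) :* s :+ s := con 0ℚ) refl ((- 1ℚ) ^ℚ k))

compS-logS-expM1 : compS logS expM1 ≐ tS
compS-logS-expM1 = ∂-injective (compS logS expM1) tS
  (≐-trans (∂-compS-expM1 logS)
    (≐-trans (compS-cong expM1 onePlusT⊛∂logS) (≐-trans (compS-oneS expM1) (≐-sym ∂tS))))
  refl
  where
  ∂tS : ∂ tS ≐ oneS
  ∂tS zero    = refl
  ∂tS (suc n) = ℚP.*-zeroʳ (ℕ→ℚ (suc (suc n)))

tOverExpM1 : Series
tOverExpM1 = invS expM1OverT

compS-logOverT-expM1 : compS logOverT expM1 ≐ tOverExpM1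
compS-logOverT-expM1 = invS-unique expM1OverT (compS logOverT expM1) refl (shiftS-injective t·E·Λ≐t)
  where
  Λ = compS logOverT expM1
  t·E·Λ≐t : shiftS (expM1OverT ⊛ Λ) ≐ shiftS oneS
  t·E·Λ≐t = ≐-trans (≐-sym (tS-⊛ (expM1OverT ⊛ Λ)))
    (≐-trans (≐-sym (⊛-assoc tS expM1OverT Λ))
      (≐-trans (⊛-congˡ Λ (≐-trans tS⊛expM1OverT (≐-sym (compS-tS expM1 refl))))
        (≐-trans (≐-sym (compS-⊛ expM1 refl tS logOverT))
          (≐-trans (compS-cong expM1 (tS-⊛ logOverT)) compS-logS-expM1))))

bernoulliGF : ℚ → Series
bernoulliGF x = tOverExpM1 ⊛ expXS x

bernoulliGF-1-x : ∀ x → ((tOverExpM1 ⊛ expS) ⊛ expXS (- x)) ≐ bernoulliGF (1ℚ - x)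
bernoulliGF-1-x x = ≐-trans (⊛-assoc tOverExpM1 expS (expXS (- x)))
  (⊛-congʳ tOverExpM1 (≐-trans (⊛-congˡ (expXS (- x)) expS≐expXS1) (expXS-+ 1ℚ (- x))))

daeheeS : ℚ → Series
daeheeS x = (onePlusT ⊛ logOverT) ⊛ binomS (- x)

compS-daeheeS-expM1 : ∀ x → compS (daeheeS x) expM1 ≐ bernoulliGF (1ℚ - x)
compS-daeheeS-expM1 x =
  ≐-trans (compS-⊛ expM1 refl (onePlusT ⊛ logOverT) (binomS (- x)))
    (≐-trans (⊛-cong (≐-trans (compS-⊛ expM1 refl onePlusT logOverT)
                                (⊛-cong compS-onePlusT-expM1 compS-logOverT-expM1))
                     (compS-binomS-expM1 (- x)))
      (≐-trans (⊛-congˡ (expXS (- x)) (⊛-comm expS tOverExpM1)) (bernoulliGF-1-x x)))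

-- The exponential generating functions of a and of its Stirling transform are related by t ↦ e^t - 1.
factℚ*compS-expM1 : ∀ a m → factℚ m * compS a expM1 m ≡ sumTo m (λ n → (factℚ n * a n) * stirling2 m n)
factℚ*compS-expM1 a m = trans (sumTo-*ˡ m (factℚ m) (λ n → a n * powS expM1 n m))
  (sumTo-cong m (λ n → sym (begin
      (factℚ n * a n) * ((factℚ m * invFact n) * powS expM1 n m)
    ≡⟨ solve 5 (λ Fn A Fm In P → (Fn :* A) :* ((Fm :* In) :* P) := (Fm :* (A :* P)) :* (Fn :* In)) refl
         (factℚ n) (a n) (factℚ m) (invFact n) (powS expM1 n m) ⟩
      factℚ m * (a n * powS expM1 n m) * (factℚ n * invFact n)
    ≡⟨ cong (factℚ m * (a n * powS expM1 n m) *_) (factℚ*invFact≡1 n) ⟩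
      factℚ m * (a n * powS expM1 n m) * 1ℚ
    ≡⟨ ℚP.*-identityʳ _ ⟩
      factℚ m * (a n * powS expM1 n m)
    ∎)))
  where open ≡-Reasoning

bernoulli[1-x]≡Σdaehee2*stirling2 : ∀ m x → bernoulli m (1ℚ - x) ≡ sumTo m (λ n → daehee2 n x * stirling2 m n)
bernoulli[1-x]≡Σdaehee2*stirling2 m x =
  trans (cong (factℚ m *_) (sym (compS-daeheeS-expM1 x m))) (factℚ*compS-expM1 (daeheeS x) m)

-- Reflection t ↦ -t

reflectS : Series → Series
reflectS a n = (- 1ℚ) ^ℚ n * a n

reflectS-cong : ∀ {a b} → a ≐ b → reflectS a ≐ reflectS b
reflectS-cong eq n = cong ((- 1ℚ) ^ℚ n *_) (eq n)

reflectS-⊛ : ∀ a b → reflectS (a ⊛ b) ≐ (reflectS a ⊛ reflectS b)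
reflectS-⊛ a b n = trans (sumTo-*ˡ n ((- 1ℚ) ^ℚ n) (λ i → a i * b (n ∸ i)))
  (sumTo-cong≤ n (λ i i≤n → trans
    (cong (_* (a i * b (n ∸ i)))
      (trans (cong ((- 1ℚ) ^ℚ_) (sym (ℕP.m+[n∸m]≡n i≤n))) (^ℚ-distribˡ-+-* (- 1ℚ) i (n ∸ i))))
    (solve 4 (λ s t x y → (s :* t) :* (x :* y) := (s :* x) :* (t :* y)) refl
      ((- 1ℚ) ^ℚ i) ((- 1ℚ) ^ℚ (n ∸ i)) (a i) (b (n ∸ i)))))

reflectS-oneS : reflectS oneS ≐ oneS
reflectS-oneS zero    = refl
reflectS-oneS (suc n) = ℚP.*-zeroʳ ((- 1ℚ) ^ℚ suc n)

reflectS-expXS : ∀ c → reflectS (expXS c) ≐ expXS (- c)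
reflectS-expXS c n = trans (sym (ℚP.*-assoc ((- 1ℚ) ^ℚ n) (c ^ℚ n) (invFact n)))
  (cong (_* invFact n) (trans (sym (^ℚ-distribʳ-* (- 1ℚ) c n))
    (cong (_^ℚ n) (trans (sym (ℚP.neg-distribˡ-* 1ℚ c)) (cong -_ (ℚP.*-identityˡ c))))))

expM1OverT⊛expXS-1 : (expM1OverT ⊛ expXS (- 1ℚ)) ≐ reflectS expM1OverT
expM1OverT⊛expXS-1 = shiftS-injective (λ n → begin
    shiftS (expM1OverT ⊛ e₋) n
  ≡⟨ sym (shiftS-⊛ expM1OverT e₋ n) ⟩
    (shiftS expM1OverT ⊛ e₋) n
  ≡⟨ ⊛-congˡ e₋ (≐-trans (≐-sym (tS-⊛ expM1OverT)) (≐-trans tS⊛expM1OverT expM1≐expS⊕-1)) n ⟩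
    ((expS ⊕ (- 1ℚ) ⊙ oneS) ⊛ e₋) n
  ≡⟨ ⊛-distribʳ-⊕ e₋ expS ((- 1ℚ) ⊙ oneS) n ⟩
    (expS ⊛ e₋) n + (((- 1ℚ) ⊙ oneS) ⊛ e₋) n
  ≡⟨ cong₂ _+_ (trans (⊛-congˡ e₋ expS≐expXS1 n) (trans (expXS-+ 1ℚ (- 1ℚ) n) (expXS-0 n)))
               (trans (⊙-⊛-assoc (- 1ℚ) oneS e₋ n) (cong (- 1ℚ *_) (⊛-identityˡ e₋ n))) ⟩
    oneS n + - 1ℚ * e₋ n
  ≡⟨ coefficient n ⟩
    shiftS (reflectS expM1OverT) n
  ∎)
  where
  open ≡-Reasoning
  e₋ = expXS (- 1ℚ)
  coefficient : ∀ n → oneS n + - 1ℚ * e₋ n ≡ shiftS (reflectS expM1OverT) n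
  coefficient zero    = refl
  coefficient (suc n) = solve 2 (λ s I → con 0ℚ :+ (:- con 1ℚ) :* (((:- con 1ℚ) :* s) :* I) := s :* I) refl
    ((- 1ℚ) ^ℚ n) (invFact (suc n))

reflectS-tOverExpM1 : reflectS tOverExpM1 ≐ (tOverExpM1 ⊛ expS)
reflectS-tOverExpM1 =
  ≐-trans (invS-unique (reflectS expM1OverT) (reflectS tOverExpM1) refl
            (≐-trans (≐-sym (reflectS-⊛ expM1OverT tOverExpM1))
              (≐-trans (reflectS-cong (⊛-inverseʳ expM1OverT refl)) reflectS-oneS)))
    (≐-sym (invS-unique (reflectS expM1OverT) (tOverExpM1 ⊛ expS) refl
      (≐-trans (⊛-congˡ (tOverExpM1 ⊛ expS) (≐-sym expM1OverT⊛expXS-1))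
        (≐-trans (⊛-interchange expM1OverT (expXS (- 1ℚ)) tOverExpM1 expS)
          (≐-trans (⊛-cong (⊛-inverseʳ expM1OverT refl)
                           (≐-trans (⊛-congʳ (expXS (- 1ℚ)) expS≐expXS1)
                             (≐-trans (expXS-+ (- 1ℚ) 1ℚ) expXS-0)))
            (⊛-identityˡ oneS))))))

reflectS-bernoulliGF : ∀ x → reflectS (bernoulliGF x) ≐ bernoulliGF (1ℚ - x)
reflectS-bernoulliGF x =
  ≐-trans (reflectS-⊛ tOverExpM1 (expXS x))
    (≐-trans (⊛-cong reflectS-tOverExpM1 (reflectS-expXS x)) (bernoulliGF-1-x x))

bernoulli[1-x]≡[-1]^m*bernoulli[x] : ∀ m x → bernoulli m (1ℚ - x) ≡ (- 1ℚ) ^ℚ m * bernoulli m x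
bernoulli[1-x]≡[-1]^m*bernoulli[x] m x =
  trans (cong (factℚ m *_) (sym (reflectS-bernoulliGF x m)))
    (solve 3 (λ F s y → F :* (s :* y) := s :* (F :* y)) refl
      (factℚ m) ((- 1ℚ) ^ℚ m) (bernoulliGF x m))

[-1]^m*bernoulli[1-x]≡bernoulli[x] : ∀ m x → (- 1ℚ) ^ℚ m * bernoulli m (1ℚ - x) ≡ bernoulli m x
[-1]^m*bernoulli[1-x]≡bernoulli[x] m x = begin
  s * bernoulli m (1ℚ - x)        ≡⟨ cong (s *_) (bernoulli[1-x]≡[-1]^m*bernoulli[x] m x) ⟩
  s * (s * bernoulli m x)         ≡⟨ sym (ℚP.*-assoc s s (bernoulli m x)) ⟩
  (s * s) * bernoulli m x         ≡⟨ cong (_* bernoulli m x) ([-1]^n*[-1]^n≡1 m) ⟩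
  1ℚ * bernoulli m x              ≡⟨ ℚP.*-identityˡ (bernoulli m x) ⟩
  bernoulli m x                   ∎
  where
  open ≡-Reasoning
  s = (- 1ℚ) ^ℚ m

-- Faulhaber's formula

powerSumS : ℕ → Series
powerSumS H n = sumBelow H (λ y → expXS (ℕ→ℚ y) n)

dilatedExpM1OverT : ℚ → Series
dilatedExpM1OverT h n = h ^ℚ suc n * invFact (suc n)

⊛-powerSumS : ∀ a H n → (a ⊛ powerSumS H) n ≡ sumBelow H (λ y → (a ⊛ expXS (ℕ→ℚ y)) n)
⊛-powerSumS a zero    n = ⊛-zeroʳ a n
⊛-powerSumS a (suc H) n = trans (⊛-distribˡ-⊕ a (powerSumS H) (expXS (ℕ→ℚ H)) n)
  (cong (_+ (a ⊛ expXS (ℕ→ℚ H)) n) (⊛-powerSumS a H n))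

expM1⊛powerSumS : ∀ H → (expM1 ⊛ powerSumS H) ≐ (expXS (ℕ→ℚ H) ⊕ (- 1ℚ) ⊙ oneS)
expM1⊛powerSumS zero    n = trans (⊛-zeroʳ expM1 n) (sym (trans (cong (_+ - 1ℚ * oneS n) (expXS-0 n))
  (solve 1 (λ o → o :+ (:- con 1ℚ) :* o := con 0ℚ) refl (oneS n))))
expM1⊛powerSumS (suc H) n = begin
    (expM1 ⊛ (powerSumS H ⊕ eH)) n
  ≡⟨ ⊛-distribˡ-⊕ expM1 (powerSumS H) eH n ⟩
    (expM1 ⊛ powerSumS H) n + (expM1 ⊛ eH) n
  ≡⟨ cong₂ _+_ (expM1⊛powerSumS H n) (trans (⊛-congˡ eH expM1≐expS⊕-1 n)
       (trans (⊛-distribʳ-⊕ eH expS ((- 1ℚ) ⊙ oneS) n)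
         (cong₂ _+_ (trans (⊛-congˡ eH expS≐expXS1 n) (expXS-+ 1ℚ (ℕ→ℚ H) n))
                    (trans (⊙-⊛-assoc (- 1ℚ) oneS eH n) (cong (- 1ℚ *_) (⊛-identityˡ eH n)))))) ⟩
    (eH n + - 1ℚ * oneS n) + (expXS (1ℚ + ℕ→ℚ H) n + - 1ℚ * eH n)
  ≡⟨ solve 3 (λ e o e′ → (e :+ (:- con 1ℚ) :* o) :+ (e′ :+ (:- con 1ℚ) :* e) := e′ :+ (:- con 1ℚ) :* o) refl
       (eH n) (oneS n) (expXS (1ℚ + ℕ→ℚ H) n) ⟩
    expXS (1ℚ + ℕ→ℚ H) n + - 1ℚ * oneS n
  ≡⟨ cong (λ z → expXS z n + - 1ℚ * oneS n) (sym (ℕ→ℚ-homo-+ 1 H)) ⟩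
    expXS (ℕ→ℚ (suc H)) n + - 1ℚ * oneS n
  ∎
  where
  open ≡-Reasoning
  eH = expXS (ℕ→ℚ H)

expM1OverT⊛powerSumS : ∀ H → (expM1OverT ⊛ powerSumS H) ≐ dilatedExpM1OverT (ℕ→ℚ H)
expM1OverT⊛powerSumS H = shiftS-injective λ n →
  trans (sym (shiftS-⊛ expM1OverT (powerSumS H) n))
    (trans (⊛-congˡ (powerSumS H) (≐-trans (≐-sym (tS-⊛ expM1OverT)) tS⊛expM1OverT) n)
      (trans (expM1⊛powerSumS H n) (coefficient n)))
  where
  coefficient : ∀ n → expXS (ℕ→ℚ H) n + - 1ℚ * oneS n ≡ shiftS (dilatedExpM1OverT (ℕ→ℚ H)) n
  coefficient zero    = refl
  coefficient (suc n) = trans (cong (λ w → expXS (ℕ→ℚ H) (suc n) + w) (ℚP.*-zeroʳ (- 1ℚ))) (ℚP.+-identityʳ _)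

faulhaber : ∀ x m H →
  sumBelow H (λ y → (x + ℕ→ℚ y) ^ℚ m) ≡ factℚ m * (dilatedExpM1OverT (ℕ→ℚ H) ⊛ bernoulliGF x) m
faulhaber x m H = sym (begin
    factℚ m * (Q ⊛ bernoulliGF x) m
  ≡⟨ cong (factℚ m *_) (powerSumS-form m) ⟩
    factℚ m * (expXS x ⊛ powerSumS H) m
  ≡⟨ cong (factℚ m *_) (⊛-powerSumS (expXS x) H m) ⟩
    factℚ m * sumBelow H (λ y → (expXS x ⊛ expXS (ℕ→ℚ y)) m)
  ≡⟨ sumBelow-*ˡ H (factℚ m) _ ⟩
    sumBelow H (λ y → factℚ m * (expXS x ⊛ expXS (ℕ→ℚ y)) m)
  ≡⟨ sumBelow-cong H (λ y → trans (cong (factℚ m *_) (expXS-+ x (ℕ→ℚ y) m))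
        (trans (solve 3 (λ F p I → F :* (p :* I) := p :* (F :* I)) refl (factℚ m) ((x + ℕ→ℚ y) ^ℚ m) (invFact m))
          (trans (cong ((x + ℕ→ℚ y) ^ℚ m *_) (factℚ*invFact≡1 m)) (ℚP.*-identityʳ _)))) ⟩
    sumBelow H (λ y → (x + ℕ→ℚ y) ^ℚ m)
  ∎)
  where
  open ≡-Reasoning
  Q = dilatedExpM1OverT (ℕ→ℚ H)
  powerSumS≐ : powerSumS H ≐ (tOverExpM1 ⊛ Q)
  powerSumS≐ = ≐-trans (≐-sym (⊛-identityˡ (powerSumS H)))
    (≐-trans (⊛-congˡ (powerSumS H) (≐-sym (⊛-inverseˡ expM1OverT refl)))
      (≐-trans (⊛-assoc tOverExpM1 expM1OverT (powerSumS H)) (⊛-congʳ tOverExpM1 (expM1OverT⊛powerSumS H))))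
  powerSumS-form : (Q ⊛ bernoulliGF x) ≐ (expXS x ⊛ powerSumS H)
  powerSumS-form = ≐-trans (⊛-comm Q (bernoulliGF x))
    (≐-trans (⊛-congˡ Q (⊛-comm tOverExpM1 (expXS x)))
      (≐-trans (⊛-assoc (expXS x) tOverExpM1 Q) (⊛-congʳ (expXS x) (≐-sym powerSumS≐))))

faulhaberRemainder : ℚ → Series → Series
faulhaberRemainder h P zero    = 0ℚ
faulhaberRemainder h P (suc k) = sumTo k (λ j → (h ^ℚ j * invFact (suc (suc j))) * P (k ∸ j))

-- (e^{ht} - 1)/t = h + h² t Σ_j h^j t^j/(j+2)!, and the second summand produces the remainder.
dilatedExpM1OverT⊛-expansion : ∀ w h P m → w * h ≡ 1ℚ →
  w * (factℚ m * (dilatedExpM1OverT h ⊛ P) m) - factℚ m * P m ≡ h * (factℚ m * faulhaberRemainder h P m)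
dilatedExpM1OverT⊛-expansion w h P zero wh≡1 = begin
    w * (1ℚ * (((h * 1ℚ) * (1ℚ * 1ℚ)) * P 0)) - 1ℚ * P 0
  ≡⟨ solve 3 (λ w h y → w :* (con 1ℚ :* (((h :* con 1ℚ) :* (con 1ℚ :* con 1ℚ)) :* y)) :- con 1ℚ :* y
                        := (w :* h) :* y :- y) refl w h (P 0) ⟩
    (w * h) * P 0 - P 0
  ≡⟨ cong (λ z → z * P 0 - P 0) wh≡1 ⟩
    1ℚ * P 0 - P 0
  ≡⟨ solve 2 (λ h y → con 1ℚ :* y :- y := h :* (con 1ℚ :* con 0ℚ)) refl h (P 0) ⟩
    h * (1ℚ * 0ℚ)
  ∎
  where open ≡-Reasoning
dilatedExpM1OverT⊛-expansion w h P (suc k) wh≡1 = begin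
    w * (F * (dilatedExpM1OverT h ⊛ P) (suc k)) - F * P (suc k)
  ≡⟨ cong (λ z → w * (F * z) - F * P (suc k)) split ⟩
    w * (F * (((h * 1ℚ) * (1ℚ * 1ℚ)) * P (suc k) + h * (h * R))) - F * P (suc k)
  ≡⟨ solve 5 (λ w h F y R → w :* (F :* (((h :* con 1ℚ) :* (con 1ℚ :* con 1ℚ)) :* y :+ h :* (h :* R))) :- F :* y
                  := (w :* h) :* (F :* y) :+ (w :* h) :* (h :* (F :* R)) :- F :* y) refl w h F (P (suc k)) R ⟩
    (w * h) * (F * P (suc k)) + (w * h) * (h * (F * R)) - F * P (suc k)
  ≡⟨ cong (λ z → z * (F * P (suc k)) + z * (h * (F * R)) - F * P (suc k)) wh≡1 ⟩
    1ℚ * (F * P (suc k)) + 1ℚ * (h * (F * R)) - F * P (suc k)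
  ≡⟨ solve 4 (λ h F y R → con 1ℚ :* (F :* y) :+ con 1ℚ :* (h :* (F :* R)) :- F :* y := h :* (F :* R)) refl
       h F (P (suc k)) R ⟩
    h * (F * R)
  ∎
  where
  open ≡-Reasoning
  F = factℚ (suc k)
  R = faulhaberRemainder h P (suc k)
  split : (dilatedExpM1OverT h ⊛ P) (suc k) ≡ ((h * 1ℚ) * (1ℚ * 1ℚ)) * P (suc k) + h * (h * R)
  split = trans (sumTo-shift k (λ i → dilatedExpM1OverT h i * P (suc k ∸ i)))
    (cong (λ z → dilatedExpM1OverT h 0 * P (suc k) + z)
      (trans (sumTo-cong k (λ j → solve 4 (λ h s I y → ((h :* (h :* s)) :* I) :* y := h :* (h :* ((s :* I) :* y))) refl
                                      h (h ^ℚ j) (invFact (suc (suc j))) (P (k ∸ j))))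
        (trans (sym (sumTo-*ˡ k h _)) (cong (h *_) (sym (sumTo-*ˡ k h _))))))

-- p-adic estimates

module _ {p : ℕ} (pr : Prime p) where

  private instance
    p≢0 : ℕ.NonZero p
    p≢0 = prime⇒nonZero pr

  p^j∣a*b⇒p^j∣b : ∀ {a} j b → ¬ p ∣ a → p ℕ.^ j ∣ a ℕ.* b → p ℕ.^ j ∣ b
  p^j∣a*b⇒p^j∣b         zero    b _   _ = 1∣ b
  p^j∣a*b⇒p^j∣b {a = a} (suc j) b p∤a p^j∣ab with euclidsLemma a b pr (∣-trans (m∣m*n (p ℕ.^ j)) p^j∣ab)
  ... | inj₁ p∣a = ⊥-elim (p∤a p∣a)
  ... | inj₂ (divides b′ refl) = subst (p ℕ.^ suc j ∣_) (ℕP.*-comm p b′)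
    (*-monoʳ-∣ p (p^j∣a*b⇒p^j∣b j b′ p∤a (*-cancelˡ-∣ p (subst (p ℕ.^ suc j ∣_) reassoc p^j∣ab))))
    where
    reassoc : a ℕ.* (b′ ℕ.* p) ≡ p ℕ.* (a ℕ.* b′)
    reassoc = trans (sym (ℕP.*-assoc a b′ p)) (ℕP.*-comm (a ℕ.* b′) p)

  n<p^n : ∀ n → n < p ℕ.^ n
  n<p^n zero    = s≤s z≤n
  n<p^n (suc n) = ℕP.≤-<-trans (n<p^n n)
    (ℕP.^-monoʳ-< p (ℕ.nonTrivial⇒n>1 p {{prime⇒nonTrivial pr}}) (ℕP.n<1+n n))

  -- A factor d < p^d cannot absorb d extra powers of p.
  p^[k+d]∣a*d⇒p^k∣a : ∀ k D a → p ℕ.^ (k ℕ.+ suc D) ∣ a ℕ.* suc D → p ℕ.^ k ∣ a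
  p^[k+d]∣a*d⇒p^k∣a zero    D a _ = 1∣ a
  p^[k+d]∣a*d⇒p^k∣a (suc k) D a p^∣ with p ∣? a
  ... | yes (divides a′ refl) = subst (p ℕ.^ suc k ∣_) (ℕP.*-comm p a′)
    (*-monoʳ-∣ p (p^[k+d]∣a*d⇒p^k∣a k D a′ (*-cancelˡ-∣ p (subst (p ℕ.^ suc (k ℕ.+ suc D) ∣_) reassoc p^∣))))
    where
    reassoc : a′ ℕ.* p ℕ.* suc D ≡ p ℕ.* (a′ ℕ.* suc D)
    reassoc = trans (ℕP.*-assoc a′ p (suc D)) (trans (cong (a′ ℕ.*_) (ℕP.*-comm p (suc D)))
      (trans (sym (ℕP.*-assoc a′ (suc D) p)) (ℕP.*-comm (a′ ℕ.* suc D) p)))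
  ... | no p∤a = ⊥-elim (ℕP.<-irrefl refl (ℕP.<-≤-trans (n<p^n (suc D))
    (ℕP.≤-trans (ℕP.^-monoʳ-≤ p (ℕP.m≤n+m (suc D) (suc k)))
      (∣⇒≤ (p^j∣a*b⇒p^j∣b (suc k ℕ.+ suc D) (suc D) p∤a p^∣)))))

  valGe-of-multiple : ∀ k (q : ℚ) D z → q * ℕ→ℚ (suc D) ≡ ℤ→ℚ z →
    p ℕ.^ (k ℕ.+ suc D) ∣ ℤ.∣ z ∣ → ValGe p k q
  valGe-of-multiple k q@(mkℚ n d _) D z q*d≡z p^∣z =
    p^[k+d]∣a*d⇒p^k∣a k D ℤ.∣ n ∣ (subst (p ℕ.^ (k ℕ.+ suc D) ∣_) numerators (∣-trans p^∣z (m∣m*n _)))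
    where
    Pu = U.mkℚᵘ n d U.* U.mkℚᵘ (+ suc D) 0
    Pu≃z : Pu U.≃ U.mkℚᵘ z 0
    Pu≃z = UP.≃-trans (UP.*-cong {U.mkℚᵘ n d} {toℚᵘ q} {U.mkℚᵘ (+ suc D) 0} {toℚᵘ (ℕ→ℚ (suc D))}
        UP.≃-refl (UP.≃-sym (ℚP.toℚᵘ-fromℚᵘ (U.mkℚᵘ (+ suc D) 0))))
      (UP.≃-trans (UP.≃-sym (ℚP.toℚᵘ-homo-* q (ℕ→ℚ (suc D))))
        (UP.≃-trans (ℚP.toℚᵘ-cong q*d≡z) (ℚP.toℚᵘ-fromℚᵘ (U.mkℚᵘ z 0))))
    numerators : ℤ.∣ z ∣ ℕ.* ℤ.∣ U.↧ Pu ∣ ≡ ℤ.∣ n ∣ ℕ.* suc D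
    numerators with Pu≃z
    ... | U.*≡* eq = trans (sym (ℤP.abs-* z (U.↧ Pu))) (trans (cong ℤ.∣_∣ (sym eq))
      (trans (ℤP.abs-* (U.↥ Pu) (+ 1)) (trans (ℕP.*-identityʳ _) (ℤP.abs-* n (+ suc D)))))

record CommonDenominator {X : Set} (g : X → ℚ) : Set where
  constructor _,_
  field
    denominator-1 : ℕ
    numerator     : ∀ x → Σ ℤ λ z → g x * ℕ→ℚ (suc denominator-1) ≡ ℤ→ℚ z

commonDenominator-const : ∀ {X} (q : ℚ) → CommonDenominator {X} (λ _ → q)
commonDenominator-const q@(mkℚ n d _) = d , λ _ → n , q*[d+1]≡n
  where
  q*[d+1]≡n : q * ℕ→ℚ (suc d) ≡ ℤ→ℚ n
  q*[d+1]≡n = trans (cong (_* ℕ→ℚ (suc d)) (sym (ℚP.↥p/↧p≡p q)))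
    (trans (sym (fromℚᵘ-homo-* (U.mkℚᵘ n d) (U.mkℚᵘ (+ suc d) 0)))
      (ℚP.fromℚᵘ-cong {U.mkℚᵘ n d U.* U.mkℚᵘ (+ suc d) 0} {U.mkℚᵘ n 0}
        (U.*≡* (trans (ℤP.*-identityʳ _) (cong (n ℤ.*_) (cong +_ (sym (ℕP.*-identityʳ (suc d)))))))))

commonDenominator-ℤ : ∀ {X} (g : X → ℤ) → CommonDenominator (λ x → ℤ→ℚ (g x))
commonDenominator-ℤ g = 0 , λ x → g x , ℚP.*-identityʳ (ℤ→ℚ (g x))

commonDenominator-+ : ∀ {X} {g h : X → ℚ} → CommonDenominator g → CommonDenominator h →
  CommonDenominator (λ x → g x + h x)
commonDenominator-+ {g = g} {h} (D₁ , int₁) (D₂ , int₂) = D₂ ℕ.+ D₁ ℕ.* suc D₂ , λ x →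
  let (z₁ , eq₁) = int₁ x ; (z₂ , eq₂) = int₂ x in
  z₁ ℤ.* + suc D₂ ℤ.+ z₂ ℤ.* + suc D₁ ,
  (begin
    (g x + h x) * ℕ→ℚ (suc D₁ ℕ.* suc D₂)
  ≡⟨ cong ((g x + h x) *_) (ℕ→ℚ-homo-* (suc D₁) (suc D₂)) ⟩
    (g x + h x) * (ℕ→ℚ (suc D₁) * ℕ→ℚ (suc D₂))
  ≡⟨ solve 4 (λ a b M N → (a :+ b) :* (M :* N) := (a :* M) :* N :+ (b :* N) :* M) refl
       (g x) (h x) (ℕ→ℚ (suc D₁)) (ℕ→ℚ (suc D₂)) ⟩
    (g x * ℕ→ℚ (suc D₁)) * ℕ→ℚ (suc D₂) + (h x * ℕ→ℚ (suc D₂)) * ℕ→ℚ (suc D₁)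
  ≡⟨ cong₂ _+_ (cong (_* ℕ→ℚ (suc D₂)) eq₁) (cong (_* ℕ→ℚ (suc D₁)) eq₂) ⟩
    ℤ→ℚ z₁ * ℤ→ℚ (+ suc D₂) + ℤ→ℚ z₂ * ℤ→ℚ (+ suc D₁)
  ≡⟨ sym (trans (ℤ→ℚ-homo-+ (z₁ ℤ.* + suc D₂) (z₂ ℤ.* + suc D₁))
       (cong₂ _+_ (ℤ→ℚ-homo-* z₁ (+ suc D₂)) (ℤ→ℚ-homo-* z₂ (+ suc D₁)))) ⟩
    ℤ→ℚ (z₁ ℤ.* + suc D₂ ℤ.+ z₂ ℤ.* + suc D₁)
  ∎)
  where open ≡-Reasoning

commonDenominator-* : ∀ {X} {g h : X → ℚ} → CommonDenominator g → CommonDenominator h →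
  CommonDenominator (λ x → g x * h x)
commonDenominator-* {g = g} {h} (D₁ , int₁) (D₂ , int₂) = D₂ ℕ.+ D₁ ℕ.* suc D₂ , λ x →
  let (z₁ , eq₁) = int₁ x ; (z₂ , eq₂) = int₂ x in
  z₁ ℤ.* z₂ ,
  (begin
    (g x * h x) * ℕ→ℚ (suc D₁ ℕ.* suc D₂)
  ≡⟨ cong ((g x * h x) *_) (ℕ→ℚ-homo-* (suc D₁) (suc D₂)) ⟩
    (g x * h x) * (ℕ→ℚ (suc D₁) * ℕ→ℚ (suc D₂))
  ≡⟨ solve 4 (λ a b M N → (a :* b) :* (M :* N) := (a :* M) :* (b :* N)) refl
       (g x) (h x) (ℕ→ℚ (suc D₁)) (ℕ→ℚ (suc D₂)) ⟩
    (g x * ℕ→ℚ (suc D₁)) * (h x * ℕ→ℚ (suc D₂))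
  ≡⟨ cong₂ _*_ eq₁ eq₂ ⟩
    ℤ→ℚ z₁ * ℤ→ℚ z₂
  ≡⟨ sym (ℤ→ℚ-homo-* z₁ z₂) ⟩
    ℤ→ℚ (z₁ ℤ.* z₂)
  ∎)
  where open ≡-Reasoning

commonDenominator-sumTo : ∀ {X} (g : ℕ → X → ℚ) → (∀ i → CommonDenominator (g i)) →
  ∀ n → CommonDenominator (λ x → sumTo n (λ i → g i x))
commonDenominator-sumTo g bounded zero    = bounded 0
commonDenominator-sumTo g bounded (suc n) =
  commonDenominator-+ (commonDenominator-sumTo g bounded n) (bounded (suc n))

commonDenominator-^ℚ : ∀ {X} {g : X → ℚ} → CommonDenominator g → ∀ n → CommonDenominator (λ x → g x ^ℚ n)
commonDenominator-^ℚ bounded zero    = commonDenominator-const 1ℚ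
commonDenominator-^ℚ bounded (suc n) = commonDenominator-* bounded (commonDenominator-^ℚ bounded n)

commonDenominator-bernoulliGF : ∀ {X} (x : X → ℤ) i → CommonDenominator (λ ξ → bernoulliGF (ℤ→ℚ (x ξ)) i)
commonDenominator-bernoulliGF x i = commonDenominator-sumTo _ (λ l →
    commonDenominator-* (commonDenominator-const (tOverExpM1 l))
      (commonDenominator-* (commonDenominator-^ℚ (commonDenominator-ℤ x) (i ∸ l))
                           (commonDenominator-const (invFact (i ∸ l)))))
  i

commonDenominator-faulhaberRemainder : ∀ {X} (h : X → ℤ) (P : X → Series) →
  (∀ i → CommonDenominator (λ ξ → P ξ i)) →
  ∀ m → CommonDenominator (λ ξ → faulhaberRemainder (ℤ→ℚ (h ξ)) (P ξ) m)
commonDenominator-faulhaberRemainder h P bounded zero    = commonDenominator-const 0ℚ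
commonDenominator-faulhaberRemainder h P bounded (suc k) = commonDenominator-sumTo _ (λ j →
    commonDenominator-* (commonDenominator-* (commonDenominator-^ℚ (commonDenominator-ℤ h) j)
                                             (commonDenominator-const (invFact (suc (suc j)))))
                        (bounded (k ∸ j)))
  k

invPow*p^N≡1 : ∀ {p} (pr : Prime p) N → invPow pr N * ℕ→ℚ (p ℕ.^ N) ≡ 1ℚ
invPow*p^N≡1 {p} pr@(prime _) N = begin
  invPow pr N * ℕ→ℚ (p ℕ.^ N)    ≡⟨ cong (invPow pr N *_) (ℕ→ℚ-homo-^ p N) ⟩
  (+ 1 / p) ^ℚ N * ℕ→ℚ p ^ℚ N    ≡⟨ sym (^ℚ-distribʳ-* (+ 1 / p) (ℕ→ℚ p) N) ⟩
  ((+ 1 / p) * ℕ→ℚ p) ^ℚ N       ≡⟨ cong (_^ℚ N) (trans (ℚP.*-comm (+ 1 / p) (ℕ→ℚ p)) (ℕ→ℚ*1/≡1 p)) ⟩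
  1ℚ ^ℚ N                         ≡⟨ 1^ℚn≡1 N ⟩
  1ℚ                              ∎
  where
  open ≡-Reasoning
  instance
    p≢0 : ℕ.NonZero p
    p≢0 = prime⇒nonZero pr

volkenbornIntegral-by-remainder : ∀ {p} (pr : Prime p) (f : ℕ → Qp) (L : Qp) (r : ℕ × ℕ → ℚ) →
  CommonDenominator r → (∀ N j → volkenbornSum pr f N j - L j ≡ ℕ→ℚ (p ℕ.^ N) * r (N , j)) →
  VolkenbornIntegral pr f L
volkenbornIntegral-by-remainder {p} pr f L r (D , numerator) error k =
  k ℕ.+ suc D , λ N k+d≤N → 0 , λ j _ →
    subst (ValGe p k) (sym (error N j))
      (valGe-of-multiple pr k (ℕ→ℚ (p ℕ.^ N) * r (N , j)) D (+ (p ℕ.^ N) ℤ.* z N j) (scaled N j) (p^[k+d]∣ N k+d≤N j))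
  where
  z : ℕ → ℕ → ℤ
  z N j = proj₁ (numerator (N , j))
  scaled : ∀ N j → (ℕ→ℚ (p ℕ.^ N) * r (N , j)) * ℕ→ℚ (suc D) ≡ ℤ→ℚ (+ (p ℕ.^ N) ℤ.* z N j)
  scaled N j = trans (ℚP.*-assoc (ℕ→ℚ (p ℕ.^ N)) (r (N , j)) (ℕ→ℚ (suc D)))
    (trans (cong (ℕ→ℚ (p ℕ.^ N) *_) (proj₂ (numerator (N , j)))) (sym (ℤ→ℚ-homo-* (+ (p ℕ.^ N)) (z N j))))
  p^[k+d]∣ : ∀ N → k ℕ.+ suc D ≤ N → ∀ j → p ℕ.^ (k ℕ.+ suc D) ∣ ℤ.∣ + (p ℕ.^ N) ℤ.* z N j ∣
  p^[k+d]∣ N k+d≤N j = subst (p ℕ.^ (k ℕ.+ suc D) ∣_) (sym (ℤP.abs-* (+ (p ℕ.^ N)) (z N j)))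
    (∣-trans (subst (p ℕ.^ (k ℕ.+ suc D) ∣_)
               (trans (sym (ℕP.^-distribˡ-+-* p (k ℕ.+ suc D) (N ∸ (k ℕ.+ suc D))))
                 (cong (p ℕ.^_) (ℕP.m+[n∸m]≡n k+d≤N)))
               (m∣m*n _))
      (m∣m*n ℤ.∣ z N j ∣))

volkenborn-power : ∀ {p} (pr : Prime p) (x : ℕ → ℤ) m →
  VolkenbornIntegral pr (λ y j → (ℤ→ℚ (x j) + ℕ→ℚ y) ^ℚ m) (λ j → (- 1ℚ) ^ℚ m * bernoulli m (1ℚ - ℤ→ℚ (x j)))
volkenborn-power {p} pr x m = volkenbornIntegral-by-remainder pr _ _ r
  (commonDenominator-* (commonDenominator-const (factℚ m))
    (commonDenominator-faulhaberRemainder (λ Nj → + (p ℕ.^ proj₁ Nj)) (λ Nj → bernoulliGF (ℤ→ℚ (x (proj₂ Nj))))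
      (commonDenominator-bernoulliGF (λ Nj → x (proj₂ Nj))) m))
  error
  where
  r : ℕ × ℕ → ℚ
  r Nj = factℚ m * faulhaberRemainder (ℕ→ℚ (p ℕ.^ proj₁ Nj)) (bernoulliGF (ℤ→ℚ (x (proj₂ Nj)))) m
  error : ∀ N j → invPow pr N * sumBelow (p ℕ.^ N) (λ y → (ℤ→ℚ (x j) + ℕ→ℚ y) ^ℚ m)
                    - (- 1ℚ) ^ℚ m * bernoulli m (1ℚ - ℤ→ℚ (x j))
                  ≡ ℕ→ℚ (p ℕ.^ N) * r (N , j)
  error N j = trans
    (cong₂ (λ a b → invPow pr N * a - b) (faulhaber X m (p ℕ.^ N)) ([-1]^m*bernoulli[1-x]≡bernoulli[x] m X))
    (dilatedExpM1OverT⊛-expansion (invPow pr N) (ℕ→ℚ (p ℕ.^ N)) (bernoulliGF X) m (invPow*p^N≡1 pr N))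
    where X = ℤ→ℚ (x j)

≡⇒≈ : ∀ p {a b : Qp} → (∀ j → a j ≡ b j) → a ≈[ p ] b
≡⇒≈ p {a} {b} eq k = 0 , λ j _ → subst (λ c → ValGe p k (c - b j)) (sym (eq j))
  (subst (ValGe p k) (sym (ℚP.+-inverseʳ (b j))) ((p ℕ.^ k) ∣0))

-- The identities hold for every integer approximant x j separately.
theorem7 : (p : ℕ) (pr : Prime p) (x : ℕ → ℤ) → IsZp p x → (m : ℕ) →
    VolkenbornIntegral pr (λ y j → (ℤ→ℚ (x j) + ℕ→ℚ y) ^ℚ m)
      (λ j → ((- 1ℚ) ^ℚ m) * bernoulli m (1ℚ - ℤ→ℚ (x j)))
    × ((λ j → bernoulli m (1ℚ - ℤ→ℚ (x j)))
        ≈[ p ] (λ j → sumTo m (λ n → daehee2 n (ℤ→ℚ (x j)) * stirling2 m n)))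
    × ((λ j → bernoulli m (1ℚ - ℤ→ℚ (x j)))
        ≈[ p ] (λ j → ((- 1ℚ) ^ℚ m) * bernoulli m (ℤ→ℚ (x j))))
theorem7 p pr x _ m =
  volkenborn-power pr x m ,
  ≡⇒≈ p (λ j → bernoulli[1-x]≡Σdaehee2*stirling2 m (ℤ→ℚ (x j))) ,
  ≡⇒≈ p (λ j → bernoulli[1-x]≡[-1]^m*bernoulli[x] m (ℤ→ℚ (x j)))
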